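{- For all $\mathcal{L}_T$-formulas and finite multisets $\Gamma,\Delta$, and all $n,m,k$: (i) If $\mathrm{LPC}\vdash^{n}_{m,k}\Gamma,T\ulcorner\varphi\urcorner\Rightarrow\Delta$, then $\mathrm{LPC}\vdash^{n}_{m,k}\Gamma,\varphi\Rightarrow\Delta$, where in the new derivation $\tau(\varphi)\le\tau(T\ulcorner\varphi\urcorner)$ if $\tau(T\ulcorner\varphi\urcorner)=0$, and $\tau(\varphi)<\tau(T\ulcorner\varphi\urcorner)$ if $\tau(T\ulcorner\varphi\urcorner)>0$ (the latter measured in the given derivation), and the $T$-complexity of the side formulas does not increase. Symmetrically, if $\mathrm{LPC}\vdash^{n}_{m,k}\Gamma\Rightarrow T\ulcorner\varphi\urcorner,\Delta$ then $\mathrm{LPC}\vdash^{n}_{m,k}\Gamma\Rightarrow\varphi,\Delta$ with the same conditions on $T$-complexities. (ii) If $\mathrm{LPC}\vdash^{n}_{m,k}\Gamma,\neg\varphi\Rightarrow\Delta$, then $\mathrm{LPC}\vdash^{n}_{m,k}\Gamma\Rightarrow\varphi,\Delta$ with $\tau(\varphi)\le\tau(\neg\varphi)$ and the $T$-complexity of the side formulas not increasing; symmetrically, if $\mathrm{LPC}\vdash^{n}_{m,k}\Gamma\Rightarrow\neg\varphi,\Delta$ then $\mathrm{LPC}\vdash^{n}_{m,k}\Gamma,\varphi\Rightarrow\Delta$ with the same conditions. (iii) If $\mathrm{LPC}\vdash^{n}_{m,k}\Gamma,\varphi\land\psi\Rightarrow\Delta$, then $\mathrm{LPC}\vdash^{n}_{m,k}\Gamma,\varphi,\psi\Rightarrow\Delta$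 with $\tau(\varphi),\tau(\psi)\le\tau(\varphi\land\psi)$ and the $T$-complexity of the side formulas not increasing. (iv) If $\mathrm{LPC}\vdash^{n}_{m,k}\Gamma\Rightarrow\varphi\land\psi,\Delta$, then $\mathrm{LPC}\vdash^{n}_{m,k}\Gamma\Rightarrow\Delta,\varphi$ and $\mathrm{LPC}\vdash^{n}_{m,k}\Gamma\Rightarrow\Delta,\psi$ with $\tau(\varphi),\tau(\psi)\le\tau(\varphi\land\psi)$, and the $T$-complexity of each side formula no greater than that of its $\tau$-maximal corresponding occurrence in the premisses. (v) If $\mathrm{LPC}\vdash^{n}_{m,k}\Gamma\Rightarrow\Delta,\forall x\varphi$, then $\mathrm{LPC}\vdash^{n}_{m,k}\Gamma\Rightarrow\Delta,\varphi(y)$ for any variable $y$ not free in $\Gamma,\Delta,\forall x\varphi$, with $\tau(\varphi(y))\le\tau(\forall x\varphi)$ and the $T$-complexity of the side formulas not increasing.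
   Context: Let $\mathcal{L}$ be a first-order language with logical constants $\neg,\land,\forall,\bot,\top$, and $\mathcal{L}_T=\mathcal{L}\cup\{T\}$ with $T$ a unary predicate symbol. For every sentence $\varphi$ of $\mathcal{L}_T$ there is a closed term $\ulcorner\varphi\urcorner$. $\bot,\top$ are not atomic. Logical complexity: $|\varphi|=0$ for atomic, $\bot,\top$; $|\neg\psi|=|\forall x\psi|=|\psi|+1$; $|\psi\land\chi|=\max(|\psi|,|\chi|)+1$. Sequents $\Gamma\Rightarrow\Delta$ have $\Gamma,\Delta$ finite multisets. LPC: initial sequents $\Gamma,\varphi\Rightarrow\varphi,\Delta$ only for $\varphi$ atomic in $\mathcal{L}$ (no $T$); $\Gamma\Rightarrow\top,\Delta$; $\Gamma,\bot\Rightarrow\Delta$. Rules (no explicit weakening/contraction): cut (from $\Gamma\Rightarrow\Delta,\varphi$ and $\varphi,\Gamma\Rightarrow\Delta$ infer $\Gamma\Rightarrow\Delta$); $(T\mathrm{l})$ $\Gamma,\varphi\Rightarrow\Delta\,/\,\Gamma,T\ulcorner\varphi\urcorner\Rightarrow\Delta$; $(T\mathrm{r})$ $\Gamma\Rightarrow\varphi,\Delta\,/\,\Gamma\Rightarrow T\ulcorner\varphi\urcorner,\Delta$; $(\neg\mathrm{l})$ $\Gamma\Rightarrow\varphi,\Delta\,/\,\Gamma,\neg\varphi\Rightarrow\Delta$; $(\neg\mathrm{r})$ $\Gamma,\varphi\Rightarrow\Delta\,/\,\Gamma\Rightarrow\neg\varphi,\Delta$; $(\land\mathrm{l})$ $\Gamma,\varphi,\psi\Rightarrow\Delta\,/\,\Gamma,\varphi\land\psi\Rightarrow\Delta$;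 $(\land\mathrm{r})$ $\Gamma\Rightarrow\varphi,\Delta$ and $\Gamma\Rightarrow\psi,\Delta\,/\,\Gamma\Rightarrow\varphi\land\psi,\Delta$; $(\forall\mathrm{l})$ $\Gamma,\forall x\varphi,\varphi(s/x)\Rightarrow\Delta\,/\,\Gamma,\forall x\varphi\Rightarrow\Delta$ ($s$ any term); $(\forall\mathrm{r})$ $\Gamma\Rightarrow\varphi(y/x),\Delta\,/\,\Gamma\Rightarrow\forall x\varphi,\Delta$ with $y$ not free in $\Gamma,\Delta,\forall x\varphi$. Length: $0$ for initial sequents, otherwise sup of (immediate subderivation lengths $+1$). Rank of a cut on $\varphi$: $|\varphi|+1$; cut rank of a derivation: max rank of its cuts ($0$ if none). $T$-complexity $\tau$ of formula occurrences, inductively: occurrences of $\mathcal{L}$-formulas have $\tau=0$; formulas of initial sequents have $\tau=0$; $(T\mathrm{l}),(T\mathrm{r})$: $\tau(T\ulcorner\varphi\urcorner)=\tau(\varphi)+1$; $(\neg\mathrm{l}),(\neg\mathrm{r})$: $\tau(\neg\varphi)=\tau(\varphi)$; $(\forall\mathrm{r})$: $\tau(\forall x\varphi)=\tau(\varphi(y/x))$; $(\land\mathrm{l}),(\land\mathrm{r})$: $\tau(\varphi\land\psi)=\max(\tau(\varphi),\tau(\psi))$; $(\forall\mathrm{l})$: the conclusion's $\forall x\varphi$ gets the max of $\tau$ of the premiss occurrences of $\forall x\varphi$ and $\varphi(s/x)$; side formulas in one-premiss rules keep their $\tau$; in $(\land\mathrm{r})$ and cut each side formula of the conclusion gets the max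 of $\tau$ of its two corresponding premiss occurrences. The $T$-complexity of a derivation is the max $\tau$ over its occurrences. $\mathrm{LPC}\vdash^{n}_{m,k}\Gamma\Rightarrow\Delta$: there is an LPC-derivation of $\Gamma\Rightarrow\Delta$ with length $\le n$, cut rank $\le m$, $T$-complexity $\le k$. -}

module Defs where

open import Data.Nat using (ℕ; zero; suc; _≤_; _<_; _⊔_)
open import Data.Nat.Properties using (_≟_)
open import Data.Vec using (Vec; []; _∷_)
open import Data.List using (List; []; _∷_; _++_; map; foldr; zipWith)
open import Data.List.Membership.Propositional using (_∈_; _∉_)
open import Data.List.Relation.Unary.All using (All)
open import Data.List.Relation.Binary.Pointwise using (Pointwise)
open import Data.List.Relation.Binary.Permutation.Propositional using (_↭_)
open import Data.Product using (Σ; _×_)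
open import Data.Unit using (⊤)
open import Data.Empty using (⊥)
open import Relation.Nullary using (yes; no)
open import Relation.Binary.PropositionalEquality using (_≡_)

record Language : Set₁ where
  field
    Func   : Set
    farity : Func → ℕ
    Rel    : Set
    rarity : Rel → ℕ

-- Syntax of 𝓛_T, locally nameless: free variables are named by ℕ
-- (fvar), bound variables are de Bruijn indices (bvar).  ∀ binds bvar 0.

module _ {L : Language} where
  open Language L

  data Tm : Set where
    fvar : ℕ → Tm
    bvar : ℕ → Tm
    app  : (f : Func) → Vec Tm (farity f) → Tm

  data Fm : Set where
    rel  : (R : Rel) → Vec Tm (rarity R) → Fm
    T    : Tm → Fm
    ⊥ᶠ   : Fm
    ⊤ᶠ   : Fm
    ¬ᶠ_  : Fm → Fm
    _∧ᶠ_ : Fm → Fm → Fm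
    ∀ᶠ   : Fm → Fm

  infix  30 ¬ᶠ_
  infixr 25 _∧ᶠ_

  mutual
    fvT : Tm → List ℕ
    fvT (fvar x)  = x ∷ []
    fvT (bvar _)  = []
    fvT (app f ts) = fvTs ts

    fvTs : ∀ {n} → Vec Tm n → List ℕ
    fvTs []       = []
    fvTs (t ∷ ts) = fvT t ++ fvTs ts

  fvF : Fm → List ℕ
  fvF (rel R ts) = fvTs ts
  fvF (T t)      = fvT t
  fvF ⊥ᶠ         = []
  fvF ⊤ᶠ         = []
  fvF (¬ᶠ φ)     = fvF φ
  fvF (φ ∧ᶠ ψ)   = fvF φ ++ fvF ψ
  fvF (∀ᶠ φ)     = fvF φ

  mutual
    lcT : ℕ → Tm → Set
    lcT k (fvar _)   = ⊤
    lcT k (bvar i)   = i < k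
    lcT k (app f ts) = lcTs k ts

    lcTs : ∀ {n} → ℕ → Vec Tm n → Set
    lcTs k []       = ⊤
    lcTs k (t ∷ ts) = lcT k t × lcTs k ts

  lcF : ℕ → Fm → Set
  lcF k (rel R ts) = lcTs k ts
  lcF k (T t)      = lcT k t
  lcF k ⊥ᶠ         = ⊤
  lcF k ⊤ᶠ         = ⊤
  lcF k (¬ᶠ φ)     = lcF k φ
  lcF k (φ ∧ᶠ ψ)   = lcF k φ × lcF k ψ
  lcF k (∀ᶠ φ)     = lcF (suc k) φ

  IsTerm : Tm → Set
  IsTerm t = lcT 0 t

  ClosedTerm : Tm → Set
  ClosedTerm t = lcT 0 t × fvT t ≡ []

  Sentence : Fm → Set
  Sentence φ = lcF 0 φ × fvF φ ≡ []

  mutual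
    openT : ℕ → Tm → Tm → Tm
    openT k s (fvar x) = fvar x
    openT k s (bvar i) with i ≟ k
    ... | yes _ = s
    ... | no  _ = bvar i
    openT k s (app f ts) = app f (openTs k s ts)

    openTs : ∀ {n} → ℕ → Tm → Vec Tm n → Vec Tm n
    openTs k s []       = []
    openTs k s (t ∷ ts) = openT k s t ∷ openTs k s ts

  openF : ℕ → Tm → Fm → Fm
  openF k s (rel R ts) = rel R (openTs k s ts)
  openF k s (T t)      = T (openT k s t)
  openF k s ⊥ᶠ         = ⊥ᶠ
  openF k s ⊤ᶠ         = ⊤ᶠ
  openF k s (¬ᶠ φ)     = ¬ᶠ openF k s φ
  openF k s (φ ∧ᶠ ψ)   = openF k s φ ∧ᶠ openF k s ψ
  openF k s (∀ᶠ φ)     = ∀ᶠ (openF (suc k) s φ)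

  -- φ(s/x) for the matrix φ of ∀xφ
  _[_] : Fm → Tm → Fm
  φ [ s ] = openF 0 s φ

  ∣_∣ : Fm → ℕ
  ∣ rel R ts ∣ = 0
  ∣ T t ∣      = 0
  ∣ ⊥ᶠ ∣       = 0
  ∣ ⊤ᶠ ∣       = 0
  ∣ ¬ᶠ φ ∣     = suc ∣ φ ∣
  ∣ φ ∧ᶠ ψ ∣   = suc (∣ φ ∣ ⊔ ∣ ψ ∣)
  ∣ ∀ᶠ φ ∣     = suc ∣ φ ∣

  LAtom : Fm → Set
  LAtom (rel R ts) = ⊤
  LAtom _          = ⊥

  -- A sequent Γ ⇒ Δ is a pair of lists of occurrences; all rules are
  -- closed under permutation of the conclusion, so lists represent
  -- finite multisets.

  record Occ : Set where
    constructor _^_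
    field
      fm : Fm
      τ  : ℕ
  open Occ public
  infix 10 _^_

  erase : List Occ → List Fm
  erase = map fm

  fvL : List Occ → List ℕ
  fvL Γ = foldr (λ o xs → fvF (fm o) ++ xs) [] Γ

  -- side formulas of a two-premiss rule: pointwise max of the τ's of
  -- corresponding occurrences
  merge : List Occ → List Occ → List Occ
  merge = zipWith (λ o o' → fm o ^ (τ o ⊔ τ o'))

  maxτ : List Occ → ℕ
  maxτ = foldr (λ o m → τ o ⊔ m) 0

  Zero : Occ → Set
  Zero o = τ o ≡ 0

  _≼_ : List Occ → List Occ → Set
  Γ' ≼ Γ = Pointwise (λ o' o → fm o' ≡ fm o × τ o' ≤ τ o) Γ' Γ

record Quotation (L : Language) : Set where
  field
    ⌜_⌝       : Fm {L} → Tm {L}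
    ⌜⌝-closed : ∀ φ → Sentence φ → ClosedTerm ⌜ φ ⌝
    ⌜⌝-inj    : ∀ φ ψ → Sentence φ → Sentence ψ → ⌜ φ ⌝ ≡ ⌜ ψ ⌝ → φ ≡ ψ

module _ {L : Language} (Q : Quotation L) where
  open Quotation Q

  data Der : List (Occ {L}) → List (Occ {L}) → Set where
    ax   : ∀ {Γ Δ} (φ : Fm) → LAtom φ → φ ∈ erase Γ → φ ∈ erase Δ →
           All Zero Γ → All Zero Δ → Der Γ Δ
    ax⊤  : ∀ {Γ Δ} → ⊤ᶠ ∈ erase Δ → All Zero Γ → All Zero Δ → Der Γ Δ
    ax⊥  : ∀ {Γ Δ} → ⊥ᶠ ∈ erase Γ → All Zero Γ → All Zero Δ → Der Γ Δ
    cut  : ∀ {Γ Δ Γ₁ Δ₁ Γ₂ Δ₂ φ a b} →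
           Der Γ₁ ((φ ^ a) ∷ Δ₁) → Der ((φ ^ b) ∷ Γ₂) Δ₂ →
           erase Γ₁ ≡ erase Γ₂ → erase Δ₁ ≡ erase Δ₂ →
           Γ ↭ merge Γ₁ Γ₂ → Δ ↭ merge Δ₁ Δ₂ → Der Γ Δ
    Tl   : ∀ {Γ Δ Γ₀ Δ₀ φ a} → Sentence φ →
           Der ((φ ^ a) ∷ Γ₀) Δ₀ →
           Γ ↭ ((T ⌜ φ ⌝ ^ suc a) ∷ Γ₀) → Δ ↭ Δ₀ → Der Γ Δ
    Tr   : ∀ {Γ Δ Γ₀ Δ₀ φ a} → Sentence φ →
           Der Γ₀ ((φ ^ a) ∷ Δ₀) →
           Γ ↭ Γ₀ → Δ ↭ ((T ⌜ φ ⌝ ^ suc a) ∷ Δ₀) → Der Γ Δ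
    ¬l   : ∀ {Γ Δ Γ₀ Δ₀ φ a} →
           Der Γ₀ ((φ ^ a) ∷ Δ₀) →
           Γ ↭ ((¬ᶠ φ ^ a) ∷ Γ₀) → Δ ↭ Δ₀ → Der Γ Δ
    ¬r   : ∀ {Γ Δ Γ₀ Δ₀ φ a} →
           Der ((φ ^ a) ∷ Γ₀) Δ₀ →
           Γ ↭ Γ₀ → Δ ↭ ((¬ᶠ φ ^ a) ∷ Δ₀) → Der Γ Δ
    ∧l   : ∀ {Γ Δ Γ₀ Δ₀ φ ψ a b} →
           Der ((φ ^ a) ∷ (ψ ^ b) ∷ Γ₀) Δ₀ →
           Γ ↭ (((φ ∧ᶠ ψ) ^ (a ⊔ b)) ∷ Γ₀) → Δ ↭ Δ₀ → Der Γ Δ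
    ∧r   : ∀ {Γ Δ Γ₁ Δ₁ Γ₂ Δ₂ φ ψ a b} →
           Der Γ₁ ((φ ^ a) ∷ Δ₁) → Der Γ₂ ((ψ ^ b) ∷ Δ₂) →
           erase Γ₁ ≡ erase Γ₂ → erase Δ₁ ≡ erase Δ₂ →
           Γ ↭ merge Γ₁ Γ₂ → Δ ↭ (((φ ∧ᶠ ψ) ^ (a ⊔ b)) ∷ merge Δ₁ Δ₂) →
           Der Γ Δ
    ∀l   : ∀ {Γ Δ Γ₀ Δ₀ φ a b} (s : Tm) → IsTerm s →
           Der ((∀ᶠ φ ^ a) ∷ (φ [ s ] ^ b) ∷ Γ₀) Δ₀ →
           Γ ↭ ((∀ᶠ φ ^ (a ⊔ b)) ∷ Γ₀) → Δ ↭ Δ₀ → Der Γ Δ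
    ∀r   : ∀ {Γ Δ Γ₀ Δ₀ φ a} (y : ℕ) →
           y ∉ fvL Γ₀ → y ∉ fvL Δ₀ → y ∉ fvF (∀ᶠ φ) →
           Der Γ₀ ((φ [ fvar y ] ^ a) ∷ Δ₀) →
           Γ ↭ Γ₀ → Δ ↭ ((∀ᶠ φ ^ a) ∷ Δ₀) → Der Γ Δ

  len : ∀ {Γ Δ} → Der Γ Δ → ℕ
  len (ax _ _ _ _ _ _)        = 0
  len (ax⊤ _ _ _)             = 0
  len (ax⊥ _ _ _)             = 0
  len (cut d e _ _ _ _)       = suc (len d ⊔ len e)
  len (Tl _ d _ _)            = suc (len d)
  len (Tr _ d _ _)            = suc (len d)
  len (¬l d _ _)              = suc (len d)
  len (¬r d _ _)              = suc (len d)
  len (∧l d _ _)              = suc (len d)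
  len (∧r d e _ _ _ _)        = suc (len d ⊔ len e)
  len (∀l _ _ d _ _)          = suc (len d)
  len (∀r _ _ _ _ d _ _)      = suc (len d)

  rank : ∀ {Γ Δ} → Der Γ Δ → ℕ
  rank (ax _ _ _ _ _ _)       = 0
  rank (ax⊤ _ _ _)            = 0
  rank (ax⊥ _ _ _)            = 0
  rank (cut {φ = φ} d e _ _ _ _) = suc ∣ φ ∣ ⊔ (rank d ⊔ rank e)
  rank (Tl _ d _ _)           = rank d
  rank (Tr _ d _ _)           = rank d
  rank (¬l d _ _)             = rank d
  rank (¬r d _ _)             = rank d
  rank (∧l d _ _)             = rank d
  rank (∧r d e _ _ _ _)       = rank d ⊔ rank e
  rank (∀l _ _ d _ _)         = rank d
  rank (∀r _ _ _ _ d _ _)     = rank d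

  tcx : ∀ {Γ Δ} → Der Γ Δ → ℕ
  tcx {Γ} {Δ} d = (maxτ Γ ⊔ maxτ Δ) ⊔ sub d
    where
    sub : ∀ {Γ Δ} → Der Γ Δ → ℕ
    sub (ax _ _ _ _ _ _)    = 0
    sub (ax⊤ _ _ _)         = 0
    sub (ax⊥ _ _ _)         = 0
    sub (cut d e _ _ _ _)   = tcx d ⊔ tcx e
    sub (Tl _ d _ _)        = tcx d
    sub (Tr _ d _ _)        = tcx d
    sub (¬l d _ _)          = tcx d
    sub (¬r d _ _)          = tcx d
    sub (∧l d _ _)          = tcx d
    sub (∧r d e _ _ _ _)    = tcx d ⊔ tcx e
    sub (∀l _ _ d _ _)      = tcx d
    sub (∀r _ _ _ _ d _ _)  = tcx d

_⊢[_,_,_]_⇒_ : {L : Language} → Quotation L → ℕ → ℕ → ℕ →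
               List (Occ {L}) → List (Occ {L}) → Set
Q ⊢[ n , m , k ] Γ ⇒ Δ =
  Σ (Der Q Γ Δ) λ d → len Q d ≤ n × rank Q d ≤ m × tcx Q d ≤ k

module Submission where

-- Every inversion is proved by one induction on the length of the derivation, uniformly in
-- the formula χ that is inverted.  An initial sequent stays initial when χ is replaced, since χ
-- is never principal in it.  If χ is principal in the last inference, the premise is already
-- the required derivation, up to renaming the eigenvariable for ∀.  Otherwise the induction
-- hypothesis is applied to the premises and the same rule is applied again, its eigenvariable
-- first renamed away from the formulas replacing χ.  Annotations are only ever lowered, so the
-- bounds on length, cut rank and T-complexity survive; a T-rule lowers the T-complexity of its
-- principal formula by one, whence the strict bound in (i).

open import Defs
open import Data.Nat using (ℕ; suc; pred; _≤_; _<_; _⊔_; z≤n; s≤s)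
open import Data.Nat.Properties
  using (_≟_; ≤-refl; ≤-trans; ⊔-assoc; ⊔-comm; ⊔-mono-≤; ⊔-lub; m≤m⊔n; m≤n⊔m; m⊔n≤o⇒m≤o; m⊔n≤o⇒n≤o;
         1+n≰n; n≤1+n; pred-mono-≤; pred[n]≤n; ≤pred⇒≤; m≤pred[n]⇒suc[m]≤n)
open import Data.Vec using (Vec; []; _∷_)
open import Data.List using (List; []; _∷_; _++_; map; foldr)
open import Data.List.Properties using (∷-injective; ++-assoc; map-++)
open import Data.List.Membership.Propositional using (_∈_; _∉_)
open import Data.List.Membership.Propositional.Properties using (∈-++⁺ˡ; ∈-++⁺ʳ; ∈-++⁻; ∈-map⁺)
open import Data.List.Relation.Unary.Any using (here; there; _─_)
open import Data.List.Relation.Unary.All using (All; []; _∷_; lookup)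
open import Data.List.Relation.Unary.All.Properties using () renaming (++⁺ to All-++)
open import Data.List.Relation.Binary.Pointwise using ([]; _∷_)
import Data.List.Relation.Binary.Pointwise as Pointwise
open import Data.List.Relation.Binary.Permutation.Propositional
  using (_↭_; prep; swap; ↭-sym; ↭-reflexive) renaming (refl to ↭-refl; trans to ↭-trans)
open import Data.List.Relation.Binary.Permutation.Propositional.Properties
  using (∈-resp-↭; All-resp-↭; map⁺; ++⁺ˡ; shift; shifts; drop-∷)
open import Data.List.Relation.Binary.Subset.Propositional using (_⊆_)
open import Data.List.Extrema.Nat using (max; xs≤max)
open import Function using (_∘_)
open import Data.Product using (Σ; ∃; ∃₂; _×_; _,_; -,_; proj₁; proj₂)
open import Data.Sum using (_⊎_; inj₁; inj₂)
open import Relation.Nullary using (¬_; yes; no)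
open import Data.Empty using (⊥-elim)
open import Relation.Binary.PropositionalEquality
  using (_≡_; _≢_; refl; sym; trans; cong; cong₂; subst; module ≡-Reasoning)

private variable
  L : Language
  Γ Δ Γ′ Δ′ X Y A B C : List (Occ {L})
  x : Occ {L}
  a b t : ℕ

⊔-≤⁻ : ∀ a b {c} → a ⊔ b ≤ c → a ≤ c × b ≤ c
⊔-≤⁻ a b a⊔b≤c = m⊔n≤o⇒m≤o a b a⊔b≤c , m⊔n≤o⇒n≤o a b a⊔b≤c

-- Annotated contexts

≼-refl : Γ ≼ Γ
≼-refl = Pointwise.refl (refl , ≤-refl)

≼-trans : A ≼ B → B ≼ C → A ≼ C
≼-trans = Pointwise.transitive (λ (e , l) (e′ , l′) → trans e e′ , ≤-trans l l′)

≼-++ : A ≼ B → X ≼ Y → (A ++ X) ≼ (B ++ Y)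
≼-++ = Pointwise.++⁺

≼-++⁻ : ∀ (A : List (Occ {L})) {X C} → C ≼ (A ++ X) → ∃₂ λ A′ X′ → A′ ≼ A × X′ ≼ X × C ≡ A′ ++ X′
≼-++⁻ []      C≼X       = [] , _ , [] , C≼X , refl
≼-++⁻ (_ ∷ A) (r ∷ C≼) with ≼-++⁻ A C≼
... | A′ , X′ , A′≼ , X′≼ , refl = _ ∷ A′ , X′ , r ∷ A′≼ , X′≼ , refl

erase-≼ : A ≼ B → erase A ≡ erase B
erase-≼ []              = refl
erase-≼ ((e , _) ∷ A≼B) = cong₂ _∷_ e (erase-≼ A≼B)

erase-++-cong : erase A ≡ erase B → erase X ≡ erase Y → erase (A ++ X) ≡ erase (B ++ Y)
erase-++-cong {A = A} {B} {X} {Y} eA eX =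
  trans (map-++ fm A X) (trans (cong₂ _++_ eA eX) (sym (map-++ fm B Y)))

↭-≼ : Γ ↭ A → B ≼ A → ∃ λ Γ′ → Γ′ ≼ Γ × Γ′ ↭ B
↭-≼ ↭-refl        B≼A             = _ , B≼A , ↭-refl
↭-≼ (prep _ σ)     (r ∷ B≼A)       with ↭-≼ σ B≼A
... | _ , Γ′≼ , π = _ , r ∷ Γ′≼ , prep _ π
↭-≼ (swap _ _ σ)   (r ∷ r′ ∷ B≼A)  with ↭-≼ σ B≼A
... | _ , Γ′≼ , π = _ , r′ ∷ r ∷ Γ′≼ , swap _ _ π
↭-≼ (↭-trans σ σ′) B≼A             with ↭-≼ σ′ B≼A
... | _ , Γ₁≼ , π with ↭-≼ σ Γ₁≼
... | _ , Γ′≼ , π′ = _ , Γ′≼ , ↭-trans π′ π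

maxτ-++ : ∀ (A : List (Occ {L})) B → maxτ (A ++ B) ≡ maxτ A ⊔ maxτ B
maxτ-++ []      B = refl
maxτ-++ (o ∷ A) B = trans (cong (τ o ⊔_) (maxτ-++ A B)) (sym (⊔-assoc (τ o) (maxτ A) (maxτ B)))

maxτ-↭ : A ↭ B → maxτ A ≡ maxτ B
maxτ-↭ ↭-refl = refl
maxτ-↭ (prep o σ) = cong (τ o ⊔_) (maxτ-↭ σ)
maxτ-↭ {A = o ∷ o′ ∷ A} (swap _ _ σ) = begin
  τ o ⊔ (τ o′ ⊔ maxτ A)  ≡⟨ sym (⊔-assoc (τ o) (τ o′) (maxτ A)) ⟩
  (τ o ⊔ τ o′) ⊔ maxτ A  ≡⟨ cong (_⊔ maxτ A) (⊔-comm (τ o) (τ o′)) ⟩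
  (τ o′ ⊔ τ o) ⊔ maxτ A  ≡⟨ ⊔-assoc (τ o′) (τ o) (maxτ A) ⟩
  τ o′ ⊔ (τ o ⊔ maxτ A)  ≡⟨ cong (λ z → τ o′ ⊔ (τ o ⊔ z)) (maxτ-↭ σ) ⟩
  _                      ∎
  where open ≡-Reasoning
maxτ-↭ (↭-trans σ σ′) = trans (maxτ-↭ σ) (maxτ-↭ σ′)

maxτ-mono : A ≼ B → maxτ A ≤ maxτ B
maxτ-mono []             = ≤-refl
maxτ-mono ((_ , l) ∷ A≼B) = ⊔-mono-≤ l (maxτ-mono A≼B)

maxτ-++-≤ : ∀ (A : List (Occ {L})) {k} → maxτ A ≤ k → Γ′ ≼ Γ → maxτ Γ ≤ k → maxτ (A ++ Γ′) ≤ k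
maxτ-++-≤ A {k} A≤k Γ′≼Γ Γ≤k = subst (_≤ k) (sym (maxτ-++ A _)) (⊔-lub A≤k (≤-trans (maxτ-mono Γ′≼Γ) Γ≤k))

maxτ-zero : All Zero A → maxτ A ≡ 0
maxτ-zero []       = refl
maxτ-zero (z ∷ zs) = cong₂ _⊔_ z (maxτ-zero zs)

maxτ-zero-≤ : ∀ {k} → All Zero Γ → All Zero Δ → (maxτ Γ ⊔ maxτ Δ) ⊔ 0 ≤ k
maxτ-zero-≤ zΓ zΔ = subst (λ M → M ⊔ 0 ≤ _) (sym (cong₂ _⊔_ (maxτ-zero zΓ) (maxτ-zero zΔ))) z≤n

merge-++ : erase A ≡ erase B → merge (A ++ X) (B ++ Y) ≡ merge A B ++ merge X Y
merge-++ {A = []}    {B = []}    _ = refl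
merge-++ {A = _ ∷ A} {B = _ ∷ B} e = cong (_ ∷_) (merge-++ {A = A} {B = B} (proj₂ (∷-injective e)))

≼-merge : A ≼ B → X ≼ Y → merge A X ≼ merge B Y
≼-merge []              _               = []
≼-merge (_ ∷ _)         []              = []
≼-merge ((e , l) ∷ A≼B) ((_ , l′) ∷ X≼Y) = (e , ⊔-mono-≤ l l′) ∷ ≼-merge A≼B X≼Y

≼-mergeˡ : erase A ≡ erase B → A ≼ merge A B
≼-mergeˡ {A = []}    {B = []}    _ = []
≼-mergeˡ {A = o ∷ A} {B = o′ ∷ B} e = (refl , m≤m⊔n (τ o) (τ o′)) ∷ ≼-mergeˡ (proj₂ (∷-injective e))

≼-mergeʳ : erase A ≡ erase B → B ≼ merge A B
≼-mergeʳ {A = []}    {B = []}    _ = []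
≼-mergeʳ {A = o ∷ A} {B = o′ ∷ B} e =
  (sym (proj₁ (∷-injective e)) , m≤n⊔m (τ o) (τ o′)) ∷ ≼-mergeʳ (proj₂ (∷-injective e))

∈-merge⁻ : erase X ≡ erase Y → (p : x ∈ merge X Y) →
  ∃₂ λ a b → Σ (fm x ^ a ∈ X) λ q → Σ (fm x ^ b ∈ Y) λ r →
    τ x ≡ a ⊔ b × (merge X Y ─ p) ≡ merge (X ─ q) (Y ─ r) × erase (X ─ q) ≡ erase (Y ─ r)
∈-merge⁻ {X = o ∷ X} {Y = o′ ∷ Y} e (here refl) =
  τ o , τ o′ , here refl , here (cong (_^ τ o′) (proj₁ (∷-injective e))) , refl , refl , proj₂ (∷-injective e)
∈-merge⁻ {X = o ∷ X} {Y = o′ ∷ Y} e (there p) with ∈-merge⁻ (proj₂ (∷-injective e)) p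
... | a , b , q , r , τ≡ , ─≡ , e′ =
  a , b , there q , there r , τ≡ , cong (_ ∷_) ─≡ , cong₂ _∷_ (proj₁ (∷-injective e)) e′

annotate : ℕ → List (Fm {L}) → List (Occ {L})
annotate a = map (_^ a)

annotate-mono : ∀ (F : List (Fm {L})) → a ≤ b → annotate a F ≼ annotate b F
annotate-mono []      _   = []
annotate-mono (_ ∷ F) a≤b = (refl , a≤b) ∷ annotate-mono F a≤b

merge-annotate : ∀ (F : List (Fm {L})) → merge (annotate a F) (annotate b F) ≡ annotate (a ⊔ b) F
merge-annotate []      = refl
merge-annotate (_ ∷ F) = cong (_ ∷_) (merge-annotate F)

erase-annotate : ∀ (F : List (Fm {L})) → erase (annotate a F) ≡ F
erase-annotate []      = refl
erase-annotate (_ ∷ F) = cong (_ ∷_) (erase-annotate F)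

annotate-zero : ∀ (F : List (Fm {L})) → All Zero (annotate 0 F)
annotate-zero []      = []
annotate-zero (_ ∷ F) = refl ∷ annotate-zero F

maxτ-annotate : ∀ (F : List (Fm {L})) → maxτ (annotate a F) ≤ a
maxτ-annotate []      = z≤n
maxτ-annotate (_ ∷ F) = ⊔-lub ≤-refl (maxτ-annotate F)

↭-─ : (p : x ∈ X) → X ↭ x ∷ (X ─ p)
↭-─ (here refl) = ↭-refl
↭-─ (there p)   = ↭-trans (prep _ (↭-─ p)) (swap _ _ ↭-refl)

∈-++-─ : ∀ (A : List (Occ {L})) (p : x ∈ A ++ X) →
  (Σ (x ∈ A) λ q → ((A ++ X) ─ p) ≡ (A ─ q) ++ X) ⊎ (Σ (x ∈ X) λ q → ((A ++ X) ─ p) ≡ A ++ (X ─ q))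
∈-++-─ []      p         = inj₂ (p , refl)
∈-++-─ (_ ∷ A) (here e)  = inj₁ (here e , refl)
∈-++-─ (_ ∷ A) (there p) with ∈-++-─ A p
... | inj₁ (q , e) = inj₁ (there q , cong (_ ∷_) e)
... | inj₂ (q , e) = inj₂ (q , cong (_ ∷_) e)

locate : x ∷ Γ ↭ A ++ X → (Σ (x ∈ A) λ p → Γ ↭ (A ─ p) ++ X) ⊎ (Σ (x ∈ X) λ q → Γ ↭ A ++ (X ─ q))
locate {A = A} σ with ∈-resp-↭ σ (here refl)
... | p with ∈-++-─ A p | drop-∷ (↭-trans σ (↭-─ p))
... | inj₁ (q , e) | σ′ = inj₁ (q , subst (_ ↭_) e σ′)
... | inj₂ (q , e) | σ′ = inj₂ (q , subst (_ ↭_) e σ′)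

↭-pull : ∀ (P : List (Occ {L})) (q : x ∈ X) → x ∷ P ++ (X ─ q) ↭ P ++ X
↭-pull P q = ↭-sym (↭-trans (++⁺ˡ P (↭-─ q)) (shift _ P _))

fvL-++ : ∀ (A : List (Occ {L})) B → fvL (A ++ B) ≡ fvL A ++ fvL B
fvL-++ []      B = refl
fvL-++ (o ∷ A) B = trans (cong (fvF (fm o) ++_) (fvL-++ A B)) (sym (++-assoc (fvF (fm o)) (fvL A) (fvL B)))

fvs : List (Fm {L}) → List ℕ
fvs = foldr (λ φ xs → fvF φ ++ xs) []

fvL-erase : ∀ (A : List (Occ {L})) → fvL A ≡ fvs (erase A)
fvL-erase []      = refl
fvL-erase (o ∷ A) = cong (fvF (fm o) ++_) (fvL-erase A)

fvL-≼ : A ≼ B → fvL A ≡ fvL B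
fvL-≼ {A = A} {B} A≼B = trans (fvL-erase A) (trans (cong fvs (erase-≼ A≼B)) (sym (fvL-erase B)))

fvL-─ : (p : x ∈ X) → fvL (X ─ p) ⊆ fvL X
fvL-─ {X = o ∷ _} (here _)  = ∈-++⁺ʳ (fvF (fm o))
fvL-─ {X = o ∷ _} (there p) q with ∈-++⁻ (fvF (fm o)) q
... | inj₁ r = ∈-++⁺ˡ r
... | inj₂ r = ∈-++⁺ʳ (fvF (fm o)) (fvL-─ p r)

fresh : List ℕ → ℕ
fresh xs = suc (max 0 xs)

fresh-∉ : ∀ xs → fresh xs ∉ xs
fresh-∉ xs p = 1+n≰n (lookup (xs≤max 0 xs) p)

-- Renaming free variables

Renaming : Set
Renaming = ℕ → ℕ

AgreeOn : List ℕ → Renaming → Renaming → Set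
AgreeOn xs ρ ρ′ = ∀ {x} → x ∈ xs → ρ x ≡ ρ′ x

∉-≡[] : ∀ {x : ℕ} {xs} → xs ≡ [] → x ∉ xs
∉-≡[] refl ()

module _ {L : Language} where
  open Language L

  mutual
    renameT : Renaming → Tm {L} → Tm {L}
    renameT ρ (fvar x)   = fvar (ρ x)
    renameT ρ (bvar i)   = bvar i
    renameT ρ (app f ts) = app f (renameTs ρ ts)

    renameTs : ∀ {n} → Renaming → Vec (Tm {L}) n → Vec (Tm {L}) n
    renameTs ρ []       = []
    renameTs ρ (t ∷ ts) = renameT ρ t ∷ renameTs ρ ts

  renameF : Renaming → Fm {L} → Fm {L}
  renameF ρ (rel R ts) = rel R (renameTs ρ ts)
  renameF ρ (T t)      = T (renameT ρ t)
  renameF ρ ⊥ᶠ         = ⊥ᶠ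
  renameF ρ ⊤ᶠ         = ⊤ᶠ
  renameF ρ (¬ᶠ φ)     = ¬ᶠ renameF ρ φ
  renameF ρ (φ ∧ᶠ ψ)   = renameF ρ φ ∧ᶠ renameF ρ ψ
  renameF ρ (∀ᶠ φ)     = ∀ᶠ (renameF ρ φ)

  renameO : Renaming → Occ {L} → Occ {L}
  renameO ρ (φ ^ a) = renameF ρ φ ^ a

  renameL : Renaming → List (Occ {L}) → List (Occ {L})
  renameL ρ = map (renameO ρ)

  mutual
    renameT-openT : ∀ ρ k s (t : Tm {L}) → renameT ρ (openT k s t) ≡ openT k (renameT ρ s) (renameT ρ t)
    renameT-openT ρ k s (fvar x) = refl
    renameT-openT ρ k s (bvar i) with i ≟ k
    ... | yes _ = refl
    ... | no _  = refl
    renameT-openT ρ k s (app f ts) = cong (app f) (renameTs-openTs ρ k s ts)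

    renameTs-openTs : ∀ {n} ρ k s (ts : Vec (Tm {L}) n) →
      renameTs ρ (openTs k s ts) ≡ openTs k (renameT ρ s) (renameTs ρ ts)
    renameTs-openTs ρ k s []       = refl
    renameTs-openTs ρ k s (t ∷ ts) = cong₂ _∷_ (renameT-openT ρ k s t) (renameTs-openTs ρ k s ts)

  renameF-openF : ∀ ρ k s (φ : Fm {L}) → renameF ρ (openF k s φ) ≡ openF k (renameT ρ s) (renameF ρ φ)
  renameF-openF ρ k s (rel R ts) = cong (rel R) (renameTs-openTs ρ k s ts)
  renameF-openF ρ k s (T t)      = cong T (renameT-openT ρ k s t)
  renameF-openF ρ k s ⊥ᶠ         = refl
  renameF-openF ρ k s ⊤ᶠ         = refl
  renameF-openF ρ k s (¬ᶠ φ)     = cong ¬ᶠ_ (renameF-openF ρ k s φ)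
  renameF-openF ρ k s (φ ∧ᶠ ψ)   = cong₂ _∧ᶠ_ (renameF-openF ρ k s φ) (renameF-openF ρ k s ψ)
  renameF-openF ρ k s (∀ᶠ φ)     = cong ∀ᶠ (renameF-openF ρ (suc k) s φ)

  mutual
    renameT-cong : ∀ {ρ ρ′} (t : Tm {L}) → AgreeOn (fvT t) ρ ρ′ → renameT ρ t ≡ renameT ρ′ t
    renameT-cong (fvar x)   ρ≗ρ′ = cong fvar (ρ≗ρ′ (here refl))
    renameT-cong (bvar i)   ρ≗ρ′ = refl
    renameT-cong (app f ts) ρ≗ρ′ = cong (app f) (renameTs-cong ts ρ≗ρ′)

    renameTs-cong : ∀ {n ρ ρ′} (ts : Vec (Tm {L}) n) → AgreeOn (fvTs ts) ρ ρ′ → renameTs ρ ts ≡ renameTs ρ′ ts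
    renameTs-cong []       ρ≗ρ′ = refl
    renameTs-cong (t ∷ ts) ρ≗ρ′ =
      cong₂ _∷_ (renameT-cong t (ρ≗ρ′ ∘ ∈-++⁺ˡ)) (renameTs-cong ts (ρ≗ρ′ ∘ ∈-++⁺ʳ (fvT t)))

  renameF-cong : ∀ {ρ ρ′} (φ : Fm {L}) → AgreeOn (fvF φ) ρ ρ′ → renameF ρ φ ≡ renameF ρ′ φ
  renameF-cong (rel R ts) ρ≗ρ′ = cong (rel R) (renameTs-cong ts ρ≗ρ′)
  renameF-cong (T t)      ρ≗ρ′ = cong T (renameT-cong t ρ≗ρ′)
  renameF-cong ⊥ᶠ         ρ≗ρ′ = refl
  renameF-cong ⊤ᶠ         ρ≗ρ′ = refl
  renameF-cong (¬ᶠ φ)     ρ≗ρ′ = cong ¬ᶠ_ (renameF-cong φ ρ≗ρ′)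
  renameF-cong (φ ∧ᶠ ψ)   ρ≗ρ′ =
    cong₂ _∧ᶠ_ (renameF-cong φ (ρ≗ρ′ ∘ ∈-++⁺ˡ)) (renameF-cong ψ (ρ≗ρ′ ∘ ∈-++⁺ʳ (fvF φ)))
  renameF-cong (∀ᶠ φ)     ρ≗ρ′ = cong ∀ᶠ (renameF-cong φ ρ≗ρ′)

  renameL-cong : ∀ {ρ ρ′} (Γ : List (Occ {L})) → AgreeOn (fvL Γ) ρ ρ′ → renameL ρ Γ ≡ renameL ρ′ Γ
  renameL-cong []      ρ≗ρ′ = refl
  renameL-cong (o ∷ Γ) ρ≗ρ′ =
    cong₂ _∷_ (cong (_^ τ o) (renameF-cong (fm o) (ρ≗ρ′ ∘ ∈-++⁺ˡ))) (renameL-cong Γ (ρ≗ρ′ ∘ ∈-++⁺ʳ (fvF (fm o))))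

  mutual
    renameT-id : (t : Tm {L}) → renameT (λ x → x) t ≡ t
    renameT-id (fvar x)   = refl
    renameT-id (bvar i)   = refl
    renameT-id (app f ts) = cong (app f) (renameTs-id ts)

    renameTs-id : ∀ {n} (ts : Vec (Tm {L}) n) → renameTs (λ x → x) ts ≡ ts
    renameTs-id []       = refl
    renameTs-id (t ∷ ts) = cong₂ _∷_ (renameT-id t) (renameTs-id ts)

  renameF-id : (φ : Fm {L}) → renameF (λ x → x) φ ≡ φ
  renameF-id (rel R ts) = cong (rel R) (renameTs-id ts)
  renameF-id (T t)      = cong T (renameT-id t)
  renameF-id ⊥ᶠ         = refl
  renameF-id ⊤ᶠ         = refl
  renameF-id (¬ᶠ φ)     = cong ¬ᶠ_ (renameF-id φ)
  renameF-id (φ ∧ᶠ ψ)   = cong₂ _∧ᶠ_ (renameF-id φ) (renameF-id ψ)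
  renameF-id (∀ᶠ φ)     = cong ∀ᶠ (renameF-id φ)

  renameL-id : (Γ : List (Occ {L})) → renameL (λ x → x) Γ ≡ Γ
  renameL-id []      = refl
  renameL-id (o ∷ Γ) = cong₂ _∷_ (cong (_^ τ o) (renameF-id (fm o))) (renameL-id Γ)

  renameF-fixes : ∀ {ρ} (φ : Fm {L}) → AgreeOn (fvF φ) ρ (λ x → x) → renameF ρ φ ≡ φ
  renameF-fixes φ ρ≗id = trans (renameF-cong φ ρ≗id) (renameF-id φ)

  renameT-fixes : ∀ {ρ} (t : Tm {L}) → AgreeOn (fvT t) ρ (λ x → x) → renameT ρ t ≡ t
  renameT-fixes t ρ≗id = trans (renameT-cong t ρ≗id) (renameT-id t)

  renameL-fixes : ∀ {ρ} (Γ : List (Occ {L})) → AgreeOn (fvL Γ) ρ (λ x → x) → renameL ρ Γ ≡ Γ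
  renameL-fixes Γ ρ≗id = trans (renameL-cong Γ ρ≗id) (renameL-id Γ)

  ∣renameF∣ : ∀ ρ (φ : Fm {L}) → ∣ renameF ρ φ ∣ ≡ ∣ φ ∣
  ∣renameF∣ ρ (rel R ts) = refl
  ∣renameF∣ ρ (T t)      = refl
  ∣renameF∣ ρ ⊥ᶠ         = refl
  ∣renameF∣ ρ ⊤ᶠ         = refl
  ∣renameF∣ ρ (¬ᶠ φ)     = cong suc (∣renameF∣ ρ φ)
  ∣renameF∣ ρ (φ ∧ᶠ ψ)   = cong suc (cong₂ _⊔_ (∣renameF∣ ρ φ) (∣renameF∣ ρ ψ))
  ∣renameF∣ ρ (∀ᶠ φ)     = cong suc (∣renameF∣ ρ φ)

  LAtom-renameF : ∀ ρ {φ : Fm {L}} → LAtom φ → LAtom (renameF ρ φ)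
  LAtom-renameF ρ {rel R ts} _ = _

  mutual
    lcT-renameT : ∀ {ρ k} (t : Tm {L}) → lcT k t → lcT k (renameT ρ t)
    lcT-renameT (fvar x)   _  = _
    lcT-renameT (bvar i)   lc = lc
    lcT-renameT (app f ts) lc = lcTs-renameTs ts lc

    lcTs-renameTs : ∀ {n ρ k} (ts : Vec (Tm {L}) n) → lcTs k ts → lcTs k (renameTs ρ ts)
    lcTs-renameTs []       _          = _
    lcTs-renameTs (t ∷ ts) (lc , lcs) = lcT-renameT t lc , lcTs-renameTs ts lcs

  erase-renameL : ∀ ρ (Γ : List (Occ {L})) → erase (renameL ρ Γ) ≡ map (renameF ρ) (erase Γ)
  erase-renameL ρ []      = refl
  erase-renameL ρ (o ∷ Γ) = cong (_ ∷_) (erase-renameL ρ Γ)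

  ∈-erase-renameL : ∀ ρ {φ} (Γ : List (Occ {L})) → φ ∈ erase Γ → renameF ρ φ ∈ erase (renameL ρ Γ)
  ∈-erase-renameL ρ Γ p = subst (_ ∈_) (sym (erase-renameL ρ Γ)) (∈-map⁺ (renameF ρ) p)

  erase-renameL-cong : ∀ ρ {Γ Δ : List (Occ {L})} → erase Γ ≡ erase Δ → erase (renameL ρ Γ) ≡ erase (renameL ρ Δ)
  erase-renameL-cong ρ {Γ} {Δ} e =
    trans (erase-renameL ρ Γ) (trans (cong (map (renameF ρ)) e) (sym (erase-renameL ρ Δ)))

  maxτ-renameL : ∀ ρ (Γ : List (Occ {L})) → maxτ (renameL ρ Γ) ≡ maxτ Γ
  maxτ-renameL ρ []      = refl
  maxτ-renameL ρ (o ∷ Γ) = cong (τ o ⊔_) (maxτ-renameL ρ Γ)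

  Zero-renameL : ∀ ρ {Γ : List (Occ {L})} → All Zero Γ → All Zero (renameL ρ Γ)
  Zero-renameL ρ []       = []
  Zero-renameL ρ (z ∷ zs) = z ∷ Zero-renameL ρ zs

  renameL-merge : ∀ ρ (Γ Δ : List (Occ {L})) → renameL ρ (merge Γ Δ) ≡ merge (renameL ρ Γ) (renameL ρ Δ)
  renameL-merge ρ []      _       = refl
  renameL-merge ρ (_ ∷ _) []      = refl
  renameL-merge ρ (_ ∷ Γ) (_ ∷ Δ) = cong (_ ∷_) (renameL-merge ρ Γ Δ)

_[_↦_] : Renaming → ℕ → ℕ → Renaming
(ρ [ w ↦ v ]) x with x ≟ w
... | yes _ = v
... | no _  = ρ x

↦-hit : ∀ ρ w v → (ρ [ w ↦ v ]) w ≡ v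
↦-hit ρ w v with w ≟ w
... | yes _  = refl
... | no w≢w = ⊥-elim (w≢w refl)

↦-miss : ∀ ρ {w} v xs → w ∉ xs → AgreeOn xs (ρ [ w ↦ v ]) ρ
↦-miss ρ {w} v xs w∉xs {x} x∈xs with x ≟ w
... | yes refl = ⊥-elim (w∉xs x∈xs)
... | no _     = refl

renameF-open-↦ : ∀ {L} ρ {w} v (φ : Fm {L}) → w ∉ fvF φ →
  renameF (ρ [ w ↦ v ]) (φ [ fvar w ]) ≡ (renameF ρ φ) [ fvar v ]
renameF-open-↦ ρ {w} v φ w∉φ = begin
  renameF (ρ [ w ↦ v ]) (φ [ fvar w ])                       ≡⟨ renameF-openF (ρ [ w ↦ v ]) 0 (fvar w) φ ⟩
  openF 0 (fvar ((ρ [ w ↦ v ]) w)) (renameF (ρ [ w ↦ v ]) φ) ≡⟨ cong₂ (λ y ψ → openF 0 (fvar y) ψ) (↦-hit ρ w v)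
                                                                        (renameF-cong φ (↦-miss ρ v (fvF φ) w∉φ)) ⟩
  (renameF ρ φ) [ fvar v ]                                   ∎
  where open ≡-Reasoning

∈-erase-++ʳ : ∀ {φ : Fm {L}} (A : List (Occ {L})) {X} → φ ∈ erase X → φ ∈ erase (A ++ X)
∈-erase-++ʳ A {X} p = subst (_ ∈_) (sym (map-++ fm A X)) (∈-++⁺ʳ (erase A) p)

-- Derivations up to permutation and renaming

Measures : Set
Measures = ℕ × ℕ × ℕ

Within : Measures → ℕ → ℕ → ℕ → Set
Within (l , r , c) n m k = l ≤ n × r ≤ m × c ≤ k

module _ {L : Language} (Q : Quotation L) where
  open Quotation Q

  measures : Der Q Γ Δ → Measures
  measures d = len Q d , rank Q d , tcx Q d

  ⊢-measures : (d : Der Q Γ Δ) {d′ : Der Q Γ′ Δ′} {n m k : ℕ} →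
    measures d′ ≡ measures d → Within (measures d) n m k → Q ⊢[ n , m , k ] Γ′ ⇒ Δ′
  ⊢-measures d {d′} eq within = d′ , subst (λ μ → Within μ _ _ _) (sym eq) within

  cast : Γ ≡ Γ′ → Δ ≡ Δ′ → Der Q Γ Δ → Der Q Γ′ Δ′
  cast refl refl d = d

  measures-cast : (e : Γ ≡ Γ′) (e′ : Δ ≡ Δ′) (d : Der Q Γ Δ) → measures (cast e e′ d) ≡ measures d
  measures-cast refl refl d = refl

  premisesTcx : Der Q Γ Δ → ℕ
  premisesTcx (ax _ _ _ _ _ _)   = 0
  premisesTcx (ax⊤ _ _ _)        = 0
  premisesTcx (ax⊥ _ _ _)        = 0
  premisesTcx (cut d e _ _ _ _)  = tcx Q d ⊔ tcx Q e
  premisesTcx (Tl _ d _ _)       = tcx Q d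
  premisesTcx (Tr _ d _ _)       = tcx Q d
  premisesTcx (¬l d _ _)         = tcx Q d
  premisesTcx (¬r d _ _)         = tcx Q d
  premisesTcx (∧l d _ _)         = tcx Q d
  premisesTcx (∧r d e _ _ _ _)   = tcx Q d ⊔ tcx Q e
  premisesTcx (∀l _ _ d _ _)     = tcx Q d
  premisesTcx (∀r _ _ _ _ d _ _) = tcx Q d

  tcx-premises : (d : Der Q Γ Δ) → tcx Q d ≡ (maxτ Γ ⊔ maxτ Δ) ⊔ premisesTcx d
  tcx-premises (ax _ _ _ _ _ _)   = refl
  tcx-premises (ax⊤ _ _ _)        = refl
  tcx-premises (ax⊥ _ _ _)        = refl
  tcx-premises (cut _ _ _ _ _ _)  = refl
  tcx-premises (Tl _ _ _ _)       = refl
  tcx-premises (Tr _ _ _ _)       = refl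
  tcx-premises (¬l _ _ _)         = refl
  tcx-premises (¬r _ _ _)         = refl
  tcx-premises (∧l _ _ _)         = refl
  tcx-premises (∧r _ _ _ _ _ _)   = refl
  tcx-premises (∀l _ _ _ _ _)     = refl
  tcx-premises (∀r _ _ _ _ _ _ _) = refl

  premisesTcx-≤ : (d : Der Q Γ Δ) {k : ℕ} → tcx Q d ≤ k → premisesTcx d ≤ k
  premisesTcx-≤ d c≤k = m⊔n≤o⇒n≤o _ _ (subst (_≤ _) (tcx-premises d) c≤k)

  ⊢-endsequent : {n m k : ℕ} → Q ⊢[ n , m , k ] Γ ⇒ Δ → maxτ Γ ≤ k × maxτ Δ ≤ k
  ⊢-endsequent {Γ = Γ} {Δ} (d , _ , _ , c≤k) =
    m⊔n≤o⇒m≤o _ _ Γ⊔Δ≤k , m⊔n≤o⇒n≤o (maxτ Γ) _ Γ⊔Δ≤k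
    where Γ⊔Δ≤k = m⊔n≤o⇒m≤o _ _ (subst (_≤ _) (tcx-premises d) c≤k)

  -- Every rule has a conclusion given only up to permutation, so permuting changes no subderivation.
  ↭-Der : (d : Der Q Γ Δ) → Γ′ ↭ Γ → Δ′ ↭ Δ →
    Σ (Der Q Γ′ Δ′) λ d′ → len Q d′ ≡ len Q d × rank Q d′ ≡ rank Q d × premisesTcx d′ ≡ premisesTcx d
  ↭-Der (ax φ φ-atom p q zΓ zΔ) σ π =
    ax φ φ-atom (∈-resp-↭ (map⁺ fm (↭-sym σ)) p) (∈-resp-↭ (map⁺ fm (↭-sym π)) q)
       (All-resp-↭ (↭-sym σ) zΓ) (All-resp-↭ (↭-sym π) zΔ) , refl , refl , refl
  ↭-Der (ax⊤ q zΓ zΔ) σ π =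
    ax⊤ (∈-resp-↭ (map⁺ fm (↭-sym π)) q) (All-resp-↭ (↭-sym σ) zΓ) (All-resp-↭ (↭-sym π) zΔ) , refl , refl , refl
  ↭-Der (ax⊥ p zΓ zΔ) σ π =
    ax⊥ (∈-resp-↭ (map⁺ fm (↭-sym σ)) p) (All-resp-↭ (↭-sym σ) zΓ) (All-resp-↭ (↭-sym π) zΔ) , refl , refl , refl
  ↭-Der (cut d e x y σ₀ π₀)     σ π = cut d e x y (↭-trans σ σ₀) (↭-trans π π₀) , refl , refl , refl
  ↭-Der (Tl s d σ₀ π₀)          σ π = Tl s d (↭-trans σ σ₀) (↭-trans π π₀) , refl , refl , refl
  ↭-Der (Tr s d σ₀ π₀)          σ π = Tr s d (↭-trans σ σ₀) (↭-trans π π₀) , refl , refl , refl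
  ↭-Der (¬l d σ₀ π₀)            σ π = ¬l d (↭-trans σ σ₀) (↭-trans π π₀) , refl , refl , refl
  ↭-Der (¬r d σ₀ π₀)            σ π = ¬r d (↭-trans σ σ₀) (↭-trans π π₀) , refl , refl , refl
  ↭-Der (∧l d σ₀ π₀)            σ π = ∧l d (↭-trans σ σ₀) (↭-trans π π₀) , refl , refl , refl
  ↭-Der (∧r d e x y σ₀ π₀)      σ π = ∧r d e x y (↭-trans σ σ₀) (↭-trans π π₀) , refl , refl , refl
  ↭-Der (∀l s i d σ₀ π₀)        σ π = ∀l s i d (↭-trans σ σ₀) (↭-trans π π₀) , refl , refl , refl
  ↭-Der (∀r y y₁ y₂ y₃ d σ₀ π₀) σ π = ∀r y y₁ y₂ y₃ d (↭-trans σ σ₀) (↭-trans π π₀) , refl , refl , refl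

  ⊢-↭ : {n m k : ℕ} → Q ⊢[ n , m , k ] Γ ⇒ Δ → Γ′ ↭ Γ → Δ′ ↭ Δ → Q ⊢[ n , m , k ] Γ′ ⇒ Δ′
  ⊢-↭ {Γ = Γ} {Δ} (d , within) σ π with ↭-Der d σ π
  ... | d′ , len≡ , rank≡ , prem≡ = ⊢-measures d (cong₂ _,_ len≡ (cong₂ _,_ rank≡ tcx≡)) within
    where
    tcx≡ : tcx Q d′ ≡ tcx Q d
    tcx≡ = trans (tcx-premises d′)
             (trans (cong₂ _⊔_ (cong₂ _⊔_ (maxτ-↭ σ) (maxτ-↭ π)) prem≡) (sym (tcx-premises d)))

  ⊢-weaken-length : {n n′ m k : ℕ} → n ≤ n′ → Q ⊢[ n , m , k ] Γ ⇒ Δ → Q ⊢[ n′ , m , k ] Γ ⇒ Δ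
  ⊢-weaken-length n≤n′ (d , l≤n , within) = d , ≤-trans l≤n n≤n′ , within

  step₁ : ℕ → Measures → Measures
  step₁ M (l , r , c) = suc l , r , M ⊔ c

  step₂ : ℕ → ℕ → Measures → Measures → Measures
  step₂ M r₀ (l , r , c) (l′ , r′ , c′) = suc (l ⊔ l′) , r₀ ⊔ (r ⊔ r′) , M ⊔ (c ⊔ c′)

  step₂-cong : ∀ {M M′ r₀ r₀′ μ₁ μ₁′ μ₂ μ₂′} → M ≡ M′ → r₀ ≡ r₀′ → μ₁ ≡ μ₁′ → μ₂ ≡ μ₂′ →
    step₂ M r₀ μ₁ μ₂ ≡ step₂ M′ r₀′ μ₁′ μ₂′
  step₂-cong refl refl refl refl = refl

  private
    ↭-rename : ∀ ρ → Γ ↭ A → renameL ρ Γ ↭ renameL ρ A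
    ↭-rename ρ = map⁺ (renameO ρ)

    maxτ₂-renameL : ∀ ρ (Γ Δ : List (Occ {L})) → maxτ (renameL ρ Γ) ⊔ maxτ (renameL ρ Δ) ≡ maxτ Γ ⊔ maxτ Δ
    maxτ₂-renameL ρ Γ Δ = cong₂ _⊔_ (maxτ-renameL ρ Γ) (maxτ-renameL ρ Δ)

    renameF-sentence : ∀ ρ {φ : Fm {L}} → Sentence φ → renameF ρ φ ≡ φ
    renameF-sentence ρ {φ} (_ , closed) = renameF-fixes φ (⊥-elim ∘ ∉-≡[] closed)

    renameT-⌜⌝ : ∀ ρ {φ : Fm {L}} → Sentence φ → renameT ρ ⌜ φ ⌝ ≡ ⌜ φ ⌝
    renameT-⌜⌝ ρ {φ} s = renameT-fixes ⌜ φ ⌝ (⊥-elim ∘ ∉-≡[] (proj₂ (⌜⌝-closed φ s)))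

  -- Eigenvariables are first moved out of the way of the renaming.
  rename : ∀ ρ (d : Der Q Γ Δ) → Σ (Der Q (renameL ρ Γ) (renameL ρ Δ)) λ d′ → measures d′ ≡ measures d
  rename {Γ = Γ} {Δ} ρ (ax φ φ-atom p q zΓ zΔ) =
    ax (renameF ρ φ) (LAtom-renameF ρ φ-atom) (∈-erase-renameL ρ Γ p) (∈-erase-renameL ρ Δ q)
       (Zero-renameL ρ zΓ) (Zero-renameL ρ zΔ) ,
    cong (λ M → 0 , 0 , M ⊔ 0) (maxτ₂-renameL ρ Γ Δ)
  rename {Γ = Γ} {Δ} ρ (ax⊤ q zΓ zΔ) =
    ax⊤ (∈-erase-renameL ρ Δ q) (Zero-renameL ρ zΓ) (Zero-renameL ρ zΔ) ,
    cong (λ M → 0 , 0 , M ⊔ 0) (maxτ₂-renameL ρ Γ Δ)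
  rename {Γ = Γ} {Δ} ρ (ax⊥ p zΓ zΔ) =
    ax⊥ (∈-erase-renameL ρ Γ p) (Zero-renameL ρ zΓ) (Zero-renameL ρ zΔ) ,
    cong (λ M → 0 , 0 , M ⊔ 0) (maxτ₂-renameL ρ Γ Δ)
  rename {Γ = Γ} {Δ} ρ (cut {Γ₁ = Γ₁} {Δ₁} {Γ₂} {Δ₂} {φ} d e eΓ eΔ σ π)
    with rename ρ d | rename ρ e
  ... | d′ , eq | e′ , eq′ =
    cut d′ e′ (erase-renameL-cong ρ eΓ) (erase-renameL-cong ρ eΔ)
        (subst (renameL ρ Γ ↭_) (renameL-merge ρ Γ₁ Γ₂) (↭-rename ρ σ))
        (subst (renameL ρ Δ ↭_) (renameL-merge ρ Δ₁ Δ₂) (↭-rename ρ π)) ,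
    step₂-cong (maxτ₂-renameL ρ Γ Δ) (cong suc (∣renameF∣ ρ φ)) eq eq′
  rename {Γ = Γ} {Δ} ρ (Tl {Γ₀ = Γ₀} {φ = φ} {a} s d σ π) with rename ρ d
  ... | d′ , eq =
    Tl s (cast (cong (λ ψ → (ψ ^ a) ∷ renameL ρ Γ₀) (renameF-sentence ρ s)) refl d′)
       (subst (λ u → renameL ρ Γ ↭ (T u ^ suc a) ∷ renameL ρ Γ₀) (renameT-⌜⌝ ρ s) (↭-rename ρ σ))
       (↭-rename ρ π) ,
    cong₂ step₁ (maxτ₂-renameL ρ Γ Δ) (trans (measures-cast _ _ d′) eq)
  rename {Γ = Γ} {Δ} ρ (Tr {Δ₀ = Δ₀} {φ = φ} {a} s d σ π) with rename ρ d
  ... | d′ , eq =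
    Tr s (cast refl (cong (λ ψ → (ψ ^ a) ∷ renameL ρ Δ₀) (renameF-sentence ρ s)) d′)
       (↭-rename ρ σ)
       (subst (λ u → renameL ρ Δ ↭ (T u ^ suc a) ∷ renameL ρ Δ₀) (renameT-⌜⌝ ρ s) (↭-rename ρ π)) ,
    cong₂ step₁ (maxτ₂-renameL ρ Γ Δ) (trans (measures-cast _ _ d′) eq)
  rename {Γ = Γ} {Δ} ρ (¬l d σ π) with rename ρ d
  ... | d′ , eq = ¬l d′ (↭-rename ρ σ) (↭-rename ρ π) , cong₂ step₁ (maxτ₂-renameL ρ Γ Δ) eq
  rename {Γ = Γ} {Δ} ρ (¬r d σ π) with rename ρ d
  ... | d′ , eq = ¬r d′ (↭-rename ρ σ) (↭-rename ρ π) , cong₂ step₁ (maxτ₂-renameL ρ Γ Δ) eq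
  rename {Γ = Γ} {Δ} ρ (∧l d σ π) with rename ρ d
  ... | d′ , eq = ∧l d′ (↭-rename ρ σ) (↭-rename ρ π) , cong₂ step₁ (maxτ₂-renameL ρ Γ Δ) eq
  rename {Γ = Γ} {Δ} ρ (∧r {Γ₁ = Γ₁} {Δ₁} {Γ₂} {Δ₂} d e eΓ eΔ σ π) with rename ρ d | rename ρ e
  ... | d′ , eq | e′ , eq′ =
    ∧r d′ e′ (erase-renameL-cong ρ eΓ) (erase-renameL-cong ρ eΔ)
       (subst (renameL ρ Γ ↭_) (renameL-merge ρ Γ₁ Γ₂) (↭-rename ρ σ))
       (subst (λ Δ′ → renameL ρ Δ ↭ _ ∷ Δ′) (renameL-merge ρ Δ₁ Δ₂) (↭-rename ρ π)) ,
    step₂-cong {r₀ = 0} {r₀′ = 0} (maxτ₂-renameL ρ Γ Δ) refl eq eq′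
  rename {Γ = Γ} {Δ} ρ (∀l {Γ₀ = Γ₀} {φ = φ} {a} {b} s s-term d σ π) with rename ρ d
  ... | d′ , eq =
    ∀l (renameT ρ s) (lcT-renameT s s-term)
       (cast (cong (λ ψ → (∀ᶠ (renameF ρ φ) ^ a) ∷ (ψ ^ b) ∷ renameL ρ Γ₀) (renameF-openF ρ 0 s φ)) refl d′)
       (↭-rename ρ σ) (↭-rename ρ π) ,
    cong₂ step₁ (maxτ₂-renameL ρ Γ Δ) (trans (measures-cast _ _ d′) eq)
  rename {Γ = Γ} {Δ} ρ (∀r {Γ₀ = Γ₀} {Δ₀} {φ} {a} w w∉Γ₀ w∉Δ₀ w∉φ d σ π) =
    ∀r v (v∉ ∘ ∈-++⁺ˡ) (v∉ ∘ ∈-++⁺ʳ xsΓ₀ ∘ ∈-++⁺ˡ) (v∉ ∘ ∈-++⁺ʳ xsΓ₀ ∘ ∈-++⁺ʳ xsΔ₀)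
       (cast (renameL-cong Γ₀ (↦-miss ρ v _ w∉Γ₀))
             (cong₂ (λ ψ Δ′ → (ψ ^ a) ∷ Δ′) (renameF-open-↦ ρ v φ w∉φ) (renameL-cong Δ₀ (↦-miss ρ v _ w∉Δ₀)))
             (proj₁ d′))
       (↭-rename ρ σ) (↭-rename ρ π) ,
    cong₂ step₁ (maxτ₂-renameL ρ Γ Δ) (trans (measures-cast _ _ (proj₁ d′)) (proj₂ d′))
    where
    xsΓ₀ = fvL (renameL ρ Γ₀)
    xsΔ₀ = fvL (renameL ρ Δ₀)
    v = fresh (xsΓ₀ ++ xsΔ₀ ++ fvF (renameF ρ φ))
    v∉ = fresh-∉ (xsΓ₀ ++ xsΔ₀ ++ fvF (renameF ρ φ))
    d′ = rename (ρ [ w ↦ v ]) d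

  ⊢-rename-eigenvariable : ∀ {n m k φ w} v → w ∉ fvL Γ → w ∉ fvL Δ → w ∉ fvF (∀ᶠ φ) →
    Q ⊢[ n , m , k ] Γ ⇒ ((φ [ fvar w ] ^ a) ∷ Δ) → Q ⊢[ n , m , k ] Γ ⇒ ((φ [ fvar v ] ^ a) ∷ Δ)
  ⊢-rename-eigenvariable {Γ = Γ} {Δ} {a = a} {φ = φ} {w} v w∉Γ w∉Δ w∉φ (d , within) =
    ⊢-measures d (trans (measures-cast eΓ eΔ (proj₁ d′)) (proj₂ d′)) within
    where
    ρ = (λ x → x) [ w ↦ v ]
    d′ = rename ρ d
    eΓ : renameL ρ Γ ≡ Γ
    eΓ = renameL-fixes Γ (↦-miss _ v _ w∉Γ)
    eΔ : renameL ρ ((φ [ fvar w ] ^ a) ∷ Δ) ≡ (φ [ fvar v ] ^ a) ∷ Δ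
    eΔ = cong₂ (λ ψ Δ′ → (ψ ^ a) ∷ Δ′)
           (trans (renameF-open-↦ _ v φ w∉φ) (cong (_[ fvar v ]) (renameF-id φ)))
           (renameL-fixes Δ (↦-miss _ v _ w∉Δ))

  private variable
    PL PR CL CR PL′ PR′ PL₁ PR₁ PL₂ PR₂ PL₁′ PR₁′ PL₂′ PR₂′ X₁ X₂ Y₁ Y₂ : List (Occ {L})
    n m k : ℕ

  -- Rules and the last inference of a derivation

  -- The one-premise rules, with premise  PL ++ X ⇒ PR ++ Y  and conclusion  CL ++ X ⇒ CR ++ Y.
  data Rule₁ : (PL PR CL CR : List (Occ {L})) → Set where
    Tl : ∀ {φ a} → Sentence φ → Rule₁ ((φ ^ a) ∷ []) [] ((T ⌜ φ ⌝ ^ suc a) ∷ []) []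
    Tr : ∀ {φ a} → Sentence φ → Rule₁ [] ((φ ^ a) ∷ []) [] ((T ⌜ φ ⌝ ^ suc a) ∷ [])
    ¬l : ∀ {φ a} → Rule₁ [] ((φ ^ a) ∷ []) ((¬ᶠ φ ^ a) ∷ []) []
    ¬r : ∀ {φ a} → Rule₁ ((φ ^ a) ∷ []) [] [] ((¬ᶠ φ ^ a) ∷ [])
    ∧l : ∀ {φ ψ a b} → Rule₁ ((φ ^ a) ∷ (ψ ^ b) ∷ []) [] (((φ ∧ᶠ ψ) ^ (a ⊔ b)) ∷ []) []
    ∀l : ∀ {φ a b} (s : Tm) → IsTerm s → Rule₁ ((∀ᶠ φ ^ a) ∷ (φ [ s ] ^ b) ∷ []) [] ((∀ᶠ φ ^ (a ⊔ b)) ∷ []) []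
    ∀r : ∀ {φ a} (y : ℕ) → y ∉ fvF (∀ᶠ φ) → Rule₁ [] ((φ [ fvar y ] ^ a) ∷ []) [] ((∀ᶠ φ ^ a) ∷ [])

  eigenvariables : Rule₁ PL PR CL CR → List ℕ
  eigenvariables (∀r y _) = y ∷ []
  eigenvariables _        = []

  FreshFor : Rule₁ PL PR CL CR → List ℕ → Set
  FreshFor R xs = ∀ {y} → y ∈ eigenvariables R → y ∉ xs

  -- The two-premise rules, with premises  PLᵢ ++ Xᵢ ⇒ PRᵢ ++ Yᵢ  and
  -- conclusion  CL ++ merge X₁ X₂ ⇒ CR ++ merge Y₁ Y₂.
  data Rule₂ : (PL₁ PR₁ PL₂ PR₂ CL CR : List (Occ {L})) → Set where
    cut : ∀ {φ a b} → Rule₂ [] ((φ ^ a) ∷ []) ((φ ^ b) ∷ []) [] [] []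
    ∧r  : ∀ {φ ψ a b} → Rule₂ [] ((φ ^ a) ∷ []) [] ((ψ ^ b) ∷ []) [] (((φ ∧ᶠ ψ) ^ (a ⊔ b)) ∷ [])

  cutRank : Rule₂ PL₁ PR₁ PL₂ PR₂ CL CR → ℕ
  cutRank (cut {φ}) = suc ∣ φ ∣
  cutRank ∧r        = 0

  Rule₂-no-left-principal : Rule₂ PL₁ PR₁ PL₂ PR₂ CL CR → x ∉ CL
  Rule₂-no-left-principal cut ()
  Rule₂-no-left-principal ∧r  ()

  infer₁ : (R : Rule₁ PL PR CL CR) → FreshFor R (fvL X) → FreshFor R (fvL Y) →
    (d : Der Q (PL ++ X) (PR ++ Y)) → Γ ↭ CL ++ X → Δ ↭ CR ++ Y →
    Σ (Der Q Γ Δ) λ e → measures e ≡ step₁ (maxτ Γ ⊔ maxτ Δ) (measures d)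
  infer₁ (Tl s)     _  _  d σ π = Tl s d σ π , refl
  infer₁ (Tr s)     _  _  d σ π = Tr s d σ π , refl
  infer₁ ¬l         _  _  d σ π = ¬l d σ π , refl
  infer₁ ¬r         _  _  d σ π = ¬r d σ π , refl
  infer₁ ∧l         _  _  d σ π = ∧l d σ π , refl
  infer₁ (∀l s s-term) _ _ d σ π = ∀l s s-term d σ π , refl
  infer₁ (∀r y y∉φ) fX fY d σ π = ∀r y (fX (here refl)) (fY (here refl)) y∉φ d σ π , refl

  infer₂ : (R : Rule₂ PL₁ PR₁ PL₂ PR₂ CL CR) →
    (d₁ : Der Q (PL₁ ++ X₁) (PR₁ ++ Y₁)) (d₂ : Der Q (PL₂ ++ X₂) (PR₂ ++ Y₂)) →
    erase X₁ ≡ erase X₂ → erase Y₁ ≡ erase Y₂ → Γ ↭ CL ++ merge X₁ X₂ → Δ ↭ CR ++ merge Y₁ Y₂ →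
    Σ (Der Q Γ Δ) λ e → measures e ≡ step₂ (maxτ Γ ⊔ maxτ Δ) (cutRank R) (measures d₁) (measures d₂)
  infer₂ cut d₁ d₂ eX eY σ π = cut d₁ d₂ eX eY σ π , refl
  infer₂ ∧r  d₁ d₂ eX eY σ π = ∧r d₁ d₂ eX eY σ π , refl

  ⊢-infer₁ : (R : Rule₁ PL PR CL CR) → FreshFor R (fvL X) → FreshFor R (fvL Y) →
    Q ⊢[ n , m , k ] (PL ++ X) ⇒ (PR ++ Y) → Γ ↭ CL ++ X → Δ ↭ CR ++ Y → maxτ Γ ≤ k → maxτ Δ ≤ k →
    Q ⊢[ suc n , m , k ] Γ ⇒ Δ
  ⊢-infer₁ R fX fY (d , l≤n , r≤m , c≤k) σ π Γ≤k Δ≤k with infer₁ R fX fY d σ π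
  ... | e , eq = ⊢-measures e refl (subst (λ μ → Within μ _ _ _) (sym eq) (s≤s l≤n , r≤m , ⊔-lub (⊔-lub Γ≤k Δ≤k) c≤k))

  ⊢-infer₂ : (R : Rule₂ PL₁ PR₁ PL₂ PR₂ CL CR) → cutRank R ≤ m →
    Q ⊢[ n , m , k ] (PL₁ ++ X₁) ⇒ (PR₁ ++ Y₁) → Q ⊢[ n , m , k ] (PL₂ ++ X₂) ⇒ (PR₂ ++ Y₂) →
    erase X₁ ≡ erase X₂ → erase Y₁ ≡ erase Y₂ → Γ ↭ CL ++ merge X₁ X₂ → Δ ↭ CR ++ merge Y₁ Y₂ →
    maxτ Γ ≤ k → maxτ Δ ≤ k → Q ⊢[ suc n , m , k ] Γ ⇒ Δ
  ⊢-infer₂ R R≤m (d₁ , l₁ , r₁ , c₁) (d₂ , l₂ , r₂ , c₂) eX eY σ π Γ≤k Δ≤k with infer₂ R d₁ d₂ eX eY σ π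
  ... | e , eq = ⊢-measures e refl
    (subst (λ μ → Within μ _ _ _) (sym eq)
      (s≤s (⊔-lub l₁ l₂) , ⊔-lub R≤m (⊔-lub r₁ r₂) , ⊔-lub (⊔-lub Γ≤k Δ≤k) (⊔-lub c₁ c₂)))

  lower₁ : (R : Rule₁ PL PR CL CR) → PL′ ≼ PL → PR′ ≼ PR →
    ∃₂ λ CL′ CR′ → Σ (Rule₁ PL′ PR′ CL′ CR′) λ R′ → CL′ ≼ CL × CR′ ≼ CR × eigenvariables R′ ≡ eigenvariables R
  lower₁ (Tl s)     ((refl , a′≤a) ∷ []) []                   = -, -, Tl s , (refl , s≤s a′≤a) ∷ [] , [] , refl
  lower₁ (Tr s)     []                   ((refl , a′≤a) ∷ [])  = -, -, Tr s , [] , (refl , s≤s a′≤a) ∷ [] , refl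
  lower₁ ¬l         []                   ((refl , a′≤a) ∷ [])  = -, -, ¬l , (refl , a′≤a) ∷ [] , [] , refl
  lower₁ ¬r         ((refl , a′≤a) ∷ []) []                    = -, -, ¬r , [] , (refl , a′≤a) ∷ [] , refl
  lower₁ ∧l         ((refl , a′≤a) ∷ (refl , b′≤b) ∷ []) []    =
    -, -, ∧l , (refl , ⊔-mono-≤ a′≤a b′≤b) ∷ [] , [] , refl
  lower₁ (∀l s s-term) ((refl , a′≤a) ∷ (refl , b′≤b) ∷ []) [] =
    -, -, ∀l s s-term , (refl , ⊔-mono-≤ a′≤a b′≤b) ∷ [] , [] , refl
  lower₁ (∀r y y∉φ) []                   ((refl , a′≤a) ∷ [])  = -, -, ∀r y y∉φ , [] , (refl , a′≤a) ∷ [] , refl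

  lower₂ : (R : Rule₂ PL₁ PR₁ PL₂ PR₂ CL CR) → PL₁′ ≼ PL₁ → PR₁′ ≼ PR₁ → PL₂′ ≼ PL₂ → PR₂′ ≼ PR₂ →
    ∃₂ λ CL′ CR′ → Σ (Rule₂ PL₁′ PR₁′ PL₂′ PR₂′ CL′ CR′) λ R′ → CL′ ≼ CL × CR′ ≼ CR × cutRank R′ ≡ cutRank R
  lower₂ cut [] ((refl , _) ∷ []) ((refl , _) ∷ []) [] = -, -, cut , [] , [] , refl
  lower₂ ∧r  [] ((refl , a′≤a) ∷ []) [] ((refl , b′≤b) ∷ []) = -, -, ∧r , [] , (refl , ⊔-mono-≤ a′≤a b′≤b) ∷ [] , refl

  data Initial (Γ Δ : List (Occ {L})) : Set where
    atom    : ∀ φ → LAtom φ → φ ∈ erase Γ → φ ∈ erase Δ → Initial Γ Δ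
    ⊤-right : ⊤ᶠ ∈ erase Δ → Initial Γ Δ
    ⊥-left  : ⊥ᶠ ∈ erase Γ → Initial Γ Δ

  ⊢-initial : Initial Γ Δ → All Zero Γ → All Zero Δ → Q ⊢[ n , m , k ] Γ ⇒ Δ
  ⊢-initial (atom φ φ-atom p q) zΓ zΔ = ax φ φ-atom p q zΓ zΔ , z≤n , z≤n , maxτ-zero-≤ zΓ zΔ
  ⊢-initial (⊤-right q)         zΓ zΔ = ax⊤ q zΓ zΔ , z≤n , z≤n , maxτ-zero-≤ zΓ zΔ
  ⊢-initial (⊥-left p)          zΓ zΔ = ax⊥ p zΓ zΔ , z≤n , z≤n , maxτ-zero-≤ zΓ zΔ

  data LastRule : ℕ → ℕ → ℕ → List (Occ {L}) → List (Occ {L}) → Set where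
    initial : Initial Γ Δ → All Zero Γ → All Zero Δ → LastRule n m k Γ Δ
    rule₁   : (R : Rule₁ PL PR CL CR) → FreshFor R (fvL X) → FreshFor R (fvL Y) →
              Q ⊢[ n , m , k ] (PL ++ X) ⇒ (PR ++ Y) → Γ ↭ CL ++ X → Δ ↭ CR ++ Y → LastRule (suc n) m k Γ Δ
    rule₂   : (R : Rule₂ PL₁ PR₁ PL₂ PR₂ CL CR) → cutRank R ≤ m →
              Q ⊢[ n , m , k ] (PL₁ ++ X₁) ⇒ (PR₁ ++ Y₁) → Q ⊢[ n , m , k ] (PL₂ ++ X₂) ⇒ (PR₂ ++ Y₂) →
              erase X₁ ≡ erase X₂ → erase Y₁ ≡ erase Y₂ →
              Γ ↭ CL ++ merge X₁ X₂ → Δ ↭ CR ++ merge Y₁ Y₂ → LastRule (suc n) m k Γ Δ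

  lastRule : Q ⊢[ n , m , k ] Γ ⇒ Δ → LastRule n m k Γ Δ
  lastRule (ax φ φ-atom p q zΓ zΔ , _) = initial (atom φ φ-atom p q) zΓ zΔ
  lastRule (ax⊤ q zΓ zΔ , _)           = initial (⊤-right q) zΓ zΔ
  lastRule (ax⊥ p zΓ zΔ , _)           = initial (⊥-left p) zΓ zΔ
  lastRule (d@(cut {φ = φ} d₁ d₂ eX eY σ π) , s≤s l , r , c) =
    rule₂ cut (proj₁ cut≤) (d₁ , proj₁ lens , proj₁ ranks , proj₁ tcxs) (d₂ , proj₂ lens , proj₂ ranks , proj₂ tcxs)
      eX eY σ π
    where
    lens  = ⊔-≤⁻ (len Q d₁) (len Q d₂) l
    cut≤  = ⊔-≤⁻ (suc ∣ φ ∣) (rank Q d₁ ⊔ rank Q d₂) r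
    ranks = ⊔-≤⁻ (rank Q d₁) (rank Q d₂) (proj₂ cut≤)
    tcxs  = ⊔-≤⁻ (tcx Q d₁) (tcx Q d₂) (premisesTcx-≤ d c)
  lastRule (d@(∧r d₁ d₂ eX eY σ π) , s≤s l , r , c) =
    rule₂ ∧r z≤n (d₁ , proj₁ lens , proj₁ ranks , proj₁ tcxs) (d₂ , proj₂ lens , proj₂ ranks , proj₂ tcxs) eX eY σ π
    where
    lens  = ⊔-≤⁻ (len Q d₁) (len Q d₂) l
    ranks = ⊔-≤⁻ (rank Q d₁) (rank Q d₂) r
    tcxs  = ⊔-≤⁻ (tcx Q d₁) (tcx Q d₂) (premisesTcx-≤ d c)
  lastRule (d@(Tl s d′ σ π) , s≤s l , r , c) = rule₁ (Tl s) (λ ()) (λ ()) (d′ , l , r , premisesTcx-≤ d c) σ π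
  lastRule (d@(Tr s d′ σ π) , s≤s l , r , c) = rule₁ (Tr s) (λ ()) (λ ()) (d′ , l , r , premisesTcx-≤ d c) σ π
  lastRule (d@(¬l d′ σ π) , s≤s l , r , c)   = rule₁ ¬l (λ ()) (λ ()) (d′ , l , r , premisesTcx-≤ d c) σ π
  lastRule (d@(¬r d′ σ π) , s≤s l , r , c)   = rule₁ ¬r (λ ()) (λ ()) (d′ , l , r , premisesTcx-≤ d c) σ π
  lastRule (d@(∧l d′ σ π) , s≤s l , r , c)   = rule₁ ∧l (λ ()) (λ ()) (d′ , l , r , premisesTcx-≤ d c) σ π
  lastRule (d@(∀l s s-term d′ σ π) , s≤s l , r , c) =
    rule₁ (∀l s s-term) (λ ()) (λ ()) (d′ , l , r , premisesTcx-≤ d c) σ π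
  lastRule (d@(∀r y y∉Γ₀ y∉Δ₀ y∉φ d′ σ π) , s≤s l , r , c) =
    rule₁ (∀r y y∉φ) (λ { (here refl) → y∉Γ₀ }) (λ { (here refl) → y∉Δ₀ }) (d′ , l , r , premisesTcx-≤ d c) σ π

  NonInitial : Fm {L} → Set
  NonInitial φ = ¬ LAtom φ × φ ≢ ⊥ᶠ × φ ≢ ⊤ᶠ

  Initial-++ : Initial Γ Δ → Initial (A ++ Γ) (B ++ Δ)
  Initial-++ {A = A} {B = B} (atom φ φ-atom p q) = atom φ φ-atom (∈-erase-++ʳ A p) (∈-erase-++ʳ B q)
  Initial-++ {B = B} (⊤-right q) = ⊤-right (∈-erase-++ʳ B q)
  Initial-++ {A = A} (⊥-left p)  = ⊥-left (∈-erase-++ʳ A p)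

  Initial-∷⁻ˡ : NonInitial (fm x) → Initial (x ∷ Γ) Δ → Initial Γ Δ
  Initial-∷⁻ˡ x-ni (atom φ φ-atom (here refl) q) = ⊥-elim (proj₁ x-ni φ-atom)
  Initial-∷⁻ˡ x-ni (atom φ φ-atom (there p) q)   = atom φ φ-atom p q
  Initial-∷⁻ˡ x-ni (⊤-right q)                   = ⊤-right q
  Initial-∷⁻ˡ x-ni (⊥-left (here e))             = ⊥-elim (proj₁ (proj₂ x-ni) (sym e))
  Initial-∷⁻ˡ x-ni (⊥-left (there p))            = ⊥-left p

  Initial-∷⁻ʳ : NonInitial (fm x) → Initial Γ (x ∷ Δ) → Initial Γ Δ
  Initial-∷⁻ʳ x-ni (atom φ φ-atom p (here refl)) = ⊥-elim (proj₁ x-ni φ-atom)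
  Initial-∷⁻ʳ x-ni (atom φ φ-atom p (there q))   = atom φ φ-atom p q
  Initial-∷⁻ʳ x-ni (⊤-right (here e))            = ⊥-elim (proj₂ (proj₂ x-ni) (sym e))
  Initial-∷⁻ʳ x-ni (⊤-right (there q))           = ⊤-right q
  Initial-∷⁻ʳ x-ni (⊥-left p)                    = ⊥-left p

  -- The index  T u  with  u ≡ ⌜ φ ⌝, rather than  T ⌜ φ ⌝, keeps the indices unifiable:
  -- ⌜_⌝ is not a constructor.
  data Principalˡ : Occ {L} → List (Occ {L}) → List (Occ {L}) → Set where
    T   : ∀ {u φ a} → Sentence φ → u ≡ ⌜ φ ⌝ → Principalˡ (T u ^ suc a) ((φ ^ a) ∷ []) []
    ¬ᶠ_ : ∀ φ {a} → Principalˡ (¬ᶠ φ ^ a) [] ((φ ^ a) ∷ [])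
    _∧ᶠ_ : ∀ φ ψ {a b} → Principalˡ ((φ ∧ᶠ ψ) ^ (a ⊔ b)) ((φ ^ a) ∷ (ψ ^ b) ∷ []) []
    ∀ᶠ  : ∀ φ {a b} (s : Tm) → Principalˡ (∀ᶠ φ ^ (a ⊔ b)) ((∀ᶠ φ ^ a) ∷ (φ [ s ] ^ b) ∷ []) []

  data Principalʳ (X Y : List (Occ {L})) : Occ {L} → List (Occ {L}) → List (Occ {L}) → Set where
    T   : ∀ {u φ a} → Sentence φ → u ≡ ⌜ φ ⌝ → Principalʳ X Y (T u ^ suc a) [] ((φ ^ a) ∷ [])
    ¬ᶠ_ : ∀ φ {a} → Principalʳ X Y (¬ᶠ φ ^ a) ((φ ^ a) ∷ []) []
    ∀ᶠ  : ∀ φ {a} (y : ℕ) → y ∉ fvL X → y ∉ fvL Y → y ∉ fvF (∀ᶠ φ) →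
          Principalʳ X Y (∀ᶠ φ ^ a) [] ((φ [ fvar y ] ^ a) ∷ [])

  data Principal₂ʳ : Occ {L} → (PL₁ PR₁ PL₂ PR₂ : List (Occ {L})) → Set where
    _∧ᶠ_ : ∀ φ ψ {a b} → Principal₂ʳ ((φ ∧ᶠ ψ) ^ (a ⊔ b)) [] ((φ ^ a) ∷ []) [] ((ψ ^ b) ∷ [])

  principalˡ : (R : Rule₁ PL PR CL CR) (p : x ∈ CL) → Γ ↭ (CL ─ p) ++ X → Δ ↭ CR ++ Y →
    Principalˡ x PL PR × Γ ↭ X × Δ ↭ Y
  principalˡ (Tl s)   (here refl) σ π = T s refl , σ , π
  principalˡ ¬l       (here refl) σ π = ¬ᶠ _ , σ , π
  principalˡ ∧l       (here refl) σ π = _ ∧ᶠ _ , σ , π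
  principalˡ (∀l s _) (here refl) σ π = ∀ᶠ _ s , σ , π

  principalʳ : (R : Rule₁ PL PR CL CR) → FreshFor R (fvL X) → FreshFor R (fvL Y) → (p : x ∈ CR) →
    Γ ↭ CL ++ X → Δ ↭ (CR ─ p) ++ Y → Principalʳ X Y x PL PR × Γ ↭ X × Δ ↭ Y
  principalʳ (Tr s)     _  _  (here refl) σ π = T s refl , σ , π
  principalʳ ¬r         _  _  (here refl) σ π = ¬ᶠ _ , σ , π
  principalʳ (∀r y y∉φ) fX fY (here refl) σ π = ∀ᶠ _ y (fX (here refl)) (fY (here refl)) y∉φ , σ , π

  principal₂ʳ : (R : Rule₂ PL₁ PR₁ PL₂ PR₂ CL CR) (p : x ∈ CR) →
    Γ ↭ CL ++ merge X₁ X₂ → Δ ↭ (CR ─ p) ++ merge Y₁ Y₂ →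
    Principal₂ʳ x PL₁ PR₁ PL₂ PR₂ × Γ ↭ merge X₁ X₂ × Δ ↭ merge Y₁ Y₂
  principal₂ʳ ∧r (here refl) σ π = _ ∧ᶠ _ , σ , π

  FreshFor-⊆ : ∀ (R : Rule₁ PL PR CL CR) {xs ys} → xs ⊆ ys → FreshFor R ys → FreshFor R xs
  FreshFor-⊆ R xs⊆ys fresh y∈ = fresh y∈ ∘ xs⊆ys

  FreshFor-++ : ∀ (R : Rule₁ PL PR CL CR) (A : List (Occ {L})) {X} →
    FreshFor R (fvL A) → FreshFor R (fvL X) → FreshFor R (fvL (A ++ X))
  FreshFor-++ R A {X} fA fX y∈ p with ∈-++⁻ (fvL A) (subst (_ ∈_) (fvL-++ A X) p)
  ... | inj₁ q = fA y∈ q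
  ... | inj₂ q = fX y∈ q

  freshen : (R : Rule₁ PL PR CL CR) → FreshFor R (fvL X) → FreshFor R (fvL Y) → (zs : List ℕ) →
    Q ⊢[ n , m , k ] (PL ++ X) ⇒ (PR ++ Y) →
    ∃₂ λ PL′ PR′ → Σ (Rule₁ PL′ PR′ CL CR) λ R′ →
      FreshFor R′ (fvL X) × FreshFor R′ (fvL Y) × FreshFor R′ zs × Q ⊢[ n , m , k ] (PL′ ++ X) ⇒ (PR′ ++ Y)
  freshen {X = X} {Y} (∀r {φ} w w∉φ) fX fY zs D =
    -, -, ∀r v (v∉ ∘ ∈-++⁺ʳ (fvL X) ∘ ∈-++⁺ʳ (fvL Y) ∘ ∈-++⁺ˡ) ,
    (λ { (here refl) → v∉ ∘ ∈-++⁺ˡ }) ,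
    (λ { (here refl) → v∉ ∘ ∈-++⁺ʳ (fvL X) ∘ ∈-++⁺ˡ }) ,
    (λ { (here refl) → v∉ ∘ ∈-++⁺ʳ (fvL X) ∘ ∈-++⁺ʳ (fvL Y) ∘ ∈-++⁺ʳ (fvF φ) }) ,
    ⊢-rename-eigenvariable v (fX (here refl)) (fY (here refl)) w∉φ D
    where
    v = fresh (fvL X ++ fvL Y ++ fvF φ ++ zs)
    v∉ = fresh-∉ (fvL X ++ fvL Y ++ fvF φ ++ zs)
  freshen (Tl s)        fX fY _ D = -, -, Tl s , fX , fY , (λ ()) , D
  freshen (Tr s)        fX fY _ D = -, -, Tr s , fX , fY , (λ ()) , D
  freshen ¬l            fX fY _ D = -, -, ¬l , fX , fY , (λ ()) , D
  freshen ¬r            fX fY _ D = -, -, ¬r , fX , fY , (λ ()) , D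
  freshen ∧l            fX fY _ D = -, -, ∧l , fX , fY , (λ ()) , D
  freshen (∀l s s-term) fX fY _ D = -, -, ∀l s s-term , fX , fY , (λ ()) , D

  -- Inverting  χ ^ t  replaces it by the formulas ante on the left and succ on the right,
  -- each annotated with at most  bound t.
  record Inversion : Set where
    field
      χ            : Fm {L}
      χ-nonInitial : NonInitial χ
      ante succ    : List (Fm {L})
      bound        : ℕ → ℕ
      bound-mono   : ∀ {a b} → a ≤ b → bound a ≤ bound b
      bound-≤      : ∀ a → bound a ≤ a

  module _ (I : Inversion) where
    open Inversion I

    Reduct : ℕ → List (Occ {L}) → List (Occ {L}) → Set
    Reduct t A B = A ≼ annotate (bound t) ante × B ≼ annotate (bound t) succ

    reduct-zero : ∀ t → Reduct t (annotate 0 ante) (annotate 0 succ)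
    reduct-zero t = annotate-mono ante z≤n , annotate-mono succ z≤n

    reduct-merge : ∀ {t₁ t₂ A₁ B₁ A₂ B₂} → Reduct t₁ A₁ B₁ → Reduct t₂ A₂ B₂ →
      erase A₁ ≡ erase A₂ × erase B₁ ≡ erase B₂ × Reduct (t₁ ⊔ t₂) (merge A₁ A₂) (merge B₁ B₂)
    reduct-merge {t₁} {t₂} (A₁≼ , B₁≼) (A₂≼ , B₂≼) =
      trans (erase-≼ A₁≼) (trans (erase-annotate ante) (sym (trans (erase-≼ A₂≼) (erase-annotate ante)))) ,
      trans (erase-≼ B₁≼) (trans (erase-annotate succ) (sym (trans (erase-≼ B₂≼) (erase-annotate succ)))) ,
      merged ante A₁≼ A₂≼ , merged succ B₁≼ B₂≼
      where
      merged : ∀ F {A₁ A₂} → A₁ ≼ annotate (bound t₁) F → A₂ ≼ annotate (bound t₂) F →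
        merge A₁ A₂ ≼ annotate (bound (t₁ ⊔ t₂)) F
      merged F A₁≼ A₂≼ = ≼-trans (≼-merge A₁≼ A₂≼)
        (subst (_≼ annotate (bound (t₁ ⊔ t₂)) F) (sym (merge-annotate F))
          (annotate-mono F (⊔-lub (bound-mono (m≤m⊔n t₁ t₂)) (bound-mono (m≤n⊔m t₁ t₂)))))

    reduct-maxτ : ∀ {t A B} → Reduct t A B → maxτ A ≤ t × maxτ B ≤ t
    reduct-maxτ {t} (A≼ , B≼) = bounded ante A≼ , bounded succ B≼
      where
      bounded : ∀ F {A} → A ≼ annotate (bound t) F → maxτ A ≤ t
      bounded F A≼ = ≤-trans (maxτ-mono A≼) (≤-trans (maxτ-annotate F) (bound-≤ t))

    reduct-fvL : ∀ {t A B} → Reduct t A B → fvL A ≡ fvs ante × fvL B ≡ fvs succ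
    reduct-fvL {A = A} {B} (A≼ , B≼) =
      trans (fvL-erase A) (cong fvs (trans (erase-≼ A≼) (erase-annotate ante))) ,
      trans (fvL-erase B) (cong fvs (trans (erase-≼ B≼) (erase-annotate succ)))

    record Inverted (n m k t : ℕ) (Γ Δ : List (Occ {L})) : Set where
      constructor inverted
      field
        {A″ B″ Γ″ Δ″} : List (Occ {L})
        reduct        : Reduct t A″ B″
        Γ″≼Γ          : Γ″ ≼ Γ
        Δ″≼Δ          : Δ″ ≼ Δ
        derivation    : Q ⊢[ n , m , k ] (A″ ++ Γ″) ⇒ (B″ ++ Δ″)

    Inverted-↭ : ∀ {n t Γ₀ Δ₀} → Inverted n m k t Γ₀ Δ₀ → Γ ↭ Γ₀ → Δ ↭ Δ₀ → Inverted n m k t Γ Δ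
    Inverted-↭ (inverted {A} {B} red Γ′≼ Δ′≼ D) σ π with ↭-≼ σ Γ′≼ | ↭-≼ π Δ′≼
    ... | _ , Γ″≼ , σ′ | _ , Δ″≼ , π′ = inverted red Γ″≼ Δ″≼ (⊢-↭ D (++⁺ˡ A σ′) (++⁺ˡ B π′))

    Inverted-weaken : ∀ {n n′ t} → n ≤ n′ → Inverted n m k t Γ Δ → Inverted n′ m k t Γ Δ
    Inverted-weaken n≤n′ (inverted red Γ′≼ Δ′≼ D) = inverted red Γ′≼ Δ′≼ (⊢-weaken-length n≤n′ D)

    reductVars : List ℕ
    reductVars = fvs ante ++ fvs succ

    private variable
      t₁ t₂ : ℕ

    reapply₁ : (R : Rule₁ PL PR CL CR) → FreshFor R (fvL X) → FreshFor R (fvL Y) → FreshFor R reductVars →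
      Inverted n m k t (PL ++ X) (PR ++ Y) → Γ ↭ CL ++ X → Δ ↭ CR ++ Y →
      t ≤ k → maxτ Γ ≤ k → maxτ Δ ≤ k → Inverted (suc n) m k t Γ Δ
    reapply₁ {PL = PL} {PR} R fX fY fV (inverted {A} {B} red Γ′≼ Δ′≼ D) σ π t≤k Γ≤k Δ≤k
      with ≼-++⁻ PL Γ′≼ | ≼-++⁻ PR Δ′≼
    ... | PL′ , X′ , PL′≼ , X′≼ , refl | PR′ , Y′ , PR′≼ , Y′≼ , refl
      with lower₁ R PL′≼ PR′≼
    ... | CL′ , CR′ , R′ , CL′≼ , CR′≼ , eig≡
      with ↭-≼ σ (≼-++ CL′≼ X′≼) | ↭-≼ π (≼-++ CR′≼ Y′≼)
    ... | _ , Γ″≼ , σ′ | _ , Δ″≼ , π′ =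
      inverted red Γ″≼ Δ″≼
        (⊢-infer₁ R′ (fresh′ A {ante} (proj₁ (reduct-fvL red)) ∈-++⁺ˡ X′≼ fX)
                     (fresh′ B {succ} (proj₂ (reduct-fvL red)) (∈-++⁺ʳ (fvs ante)) Y′≼ fY)
           (⊢-↭ D (shifts PL′ A) (shifts PR′ B))
           (↭-trans (++⁺ˡ A σ′) (shifts A CL′)) (↭-trans (++⁺ˡ B π′) (shifts B CR′))
           (maxτ-++-≤ A (≤-trans (proj₁ (reduct-maxτ red)) t≤k) Γ″≼ Γ≤k)
           (maxτ-++-≤ B (≤-trans (proj₂ (reduct-maxτ red)) t≤k) Δ″≼ Δ≤k))
      where
      fresh′ : ∀ (A : List (Occ {L})) {F X′ X} → fvL A ≡ fvs F → fvs F ⊆ reductVars → X′ ≼ X →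
        FreshFor R (fvL X) → FreshFor R′ (fvL (A ++ X′))
      fresh′ A {X′ = X′} A≡F F⊆ X′≼X fX y∈ =
        FreshFor-++ R A {X′} (FreshFor-⊆ R (F⊆ ∘ subst (_ ∈_) A≡F) fV)
                             (FreshFor-⊆ R (subst (_ ∈_) (fvL-≼ X′≼X)) fX)
                             (subst (_ ∈_) eig≡ y∈)

    reapply₂ : (R : Rule₂ PL₁ PR₁ PL₂ PR₂ CL CR) → cutRank R ≤ m →
      Inverted n m k t₁ (PL₁ ++ X₁) (PR₁ ++ Y₁) → Inverted n m k t₂ (PL₂ ++ X₂) (PR₂ ++ Y₂) →
      erase X₁ ≡ erase X₂ → erase Y₁ ≡ erase Y₂ → Γ ↭ CL ++ merge X₁ X₂ → Δ ↭ CR ++ merge Y₁ Y₂ →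
      t₁ ⊔ t₂ ≤ k → maxτ Γ ≤ k → maxτ Δ ≤ k → Inverted (suc n) m k (t₁ ⊔ t₂) Γ Δ
    reapply₂ {PL₁ = PL₁} {PR₁} {PL₂} {PR₂} R R≤m
      (inverted {A₁} {B₁} red₁ Γ₁≼ Δ₁≼ D₁) (inverted {A₂} {B₂} red₂ Γ₂≼ Δ₂≼ D₂) eX eY σ π t≤k Γ≤k Δ≤k
      with ≼-++⁻ PL₁ Γ₁≼ | ≼-++⁻ PR₁ Δ₁≼ | ≼-++⁻ PL₂ Γ₂≼ | ≼-++⁻ PR₂ Δ₂≼
    ... | PL₁′ , X₁′ , PL₁′≼ , X₁′≼ , refl | PR₁′ , Y₁′ , PR₁′≼ , Y₁′≼ , refl
        | PL₂′ , X₂′ , PL₂′≼ , X₂′≼ , refl | PR₂′ , Y₂′ , PR₂′≼ , Y₂′≼ , refl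
      with lower₂ R PL₁′≼ PR₁′≼ PL₂′≼ PR₂′≼ | reduct-merge red₁ red₂
    ... | CL′ , CR′ , R′ , CL′≼ , CR′≼ , rank≡ | eA , eB , red
      with ↭-≼ σ (≼-++ CL′≼ (≼-merge X₁′≼ X₂′≼)) | ↭-≼ π (≼-++ CR′≼ (≼-merge Y₁′≼ Y₂′≼))
    ... | _ , Γ″≼ , σ′ | _ , Δ″≼ , π′ =
      inverted red Γ″≼ Δ″≼
        (⊢-infer₂ R′ (subst (_≤ _) (sym rank≡) R≤m)
           (⊢-↭ D₁ (shifts PL₁′ A₁) (shifts PR₁′ B₁)) (⊢-↭ D₂ (shifts PL₂′ A₂) (shifts PR₂′ B₂))
           (erase-++-cong eA (trans (erase-≼ X₁′≼) (trans eX (sym (erase-≼ X₂′≼)))))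
           (erase-++-cong eB (trans (erase-≼ Y₁′≼) (trans eY (sym (erase-≼ Y₂′≼)))))
           (↭-merge-++ A₁ A₂ eA σ′) (↭-merge-++ B₁ B₂ eB π′)
           (maxτ-++-≤ (merge A₁ A₂) (≤-trans (proj₁ (reduct-maxτ red)) t≤k) Γ″≼ Γ≤k)
           (maxτ-++-≤ (merge B₁ B₂) (≤-trans (proj₂ (reduct-maxτ red)) t≤k) Δ″≼ Δ≤k))
      where
      ↭-merge-++ : ∀ (A₁ A₂ : List (Occ {L})) {C Z Z₁ Z₂} → erase A₁ ≡ erase A₂ → Z ↭ C ++ merge Z₁ Z₂ →
        merge A₁ A₂ ++ Z ↭ C ++ merge (A₁ ++ Z₁) (A₂ ++ Z₂)
      ↭-merge-++ A₁ A₂ {C} eA ρ = ↭-trans (++⁺ˡ (merge A₁ A₂) ρ)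
        (↭-trans (shifts (merge A₁ A₂) C) (↭-reflexive (cong (C ++_) (sym (merge-++ eA)))))

    PrincipalLeft : Set
    PrincipalLeft = ∀ {n m k t PL PR X Y} → Principalˡ (χ ^ t) PL PR →
      Q ⊢[ n , m , k ] (PL ++ X) ⇒ (PR ++ Y) → Inverted n m k t X Y

    invertˡ : PrincipalLeft → ∀ n → Q ⊢[ n , m , k ] ((χ ^ t) ∷ Γ) ⇒ Δ → Inverted n m k t Γ Δ
    invertˡ principal n D with lastRule D | ⊢-endsequent D
    ... | initial i (_ ∷ zΓ) zΔ | _ =
      inverted (reduct-zero _) ≼-refl ≼-refl
        (⊢-initial (Initial-++ (Initial-∷⁻ˡ χ-nonInitial i))
                   (All-++ (annotate-zero ante) zΓ) (All-++ (annotate-zero succ) zΔ))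
    ... | rule₁ R fX fY D′ σ π | t⊔Γ≤k , Δ≤k with locate σ
    ...   | inj₁ (p , σ′) =
      let P , σ″ , π′ = principalˡ R p σ′ π in Inverted-weaken (n≤1+n _) (Inverted-↭ (principal P D′) σ″ π′)
    ...   | inj₂ (q , σ′) with freshen R fX fY reductVars D′
    ...     | _ , _ , R′ , fX′ , fY′ , fV , D″ =
      reapply₁ R′ (FreshFor-⊆ R′ (fvL-─ q) fX′) fY′ fV (invertˡ principal _ (⊢-↭ D″ (↭-pull _ q) ↭-refl))
        σ′ π (proj₁ (⊔-≤⁻ _ _ t⊔Γ≤k)) (proj₂ (⊔-≤⁻ _ _ t⊔Γ≤k)) Δ≤k
    invertˡ principal n D | rule₂ R R≤m D₁ D₂ eX eY σ π | t⊔Γ≤k , Δ≤k with locate σ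
    ...   | inj₁ (p , _) = ⊥-elim (Rule₂-no-left-principal R p)
    ...   | inj₂ (q , σ′) with ∈-merge⁻ eX q
    ...     | _ , _ , q₁ , q₂ , refl , ─≡ , e─ =
      reapply₂ R R≤m (invertˡ principal _ (⊢-↭ D₁ (↭-pull _ q₁) ↭-refl))
                     (invertˡ principal _ (⊢-↭ D₂ (↭-pull _ q₂) ↭-refl))
        e─ eY (subst (λ Z → _ ↭ _ ++ Z) ─≡ σ′) π (proj₁ (⊔-≤⁻ _ _ t⊔Γ≤k)) (proj₂ (⊔-≤⁻ _ _ t⊔Γ≤k)) Δ≤k

    PrincipalRight₁ : Set
    PrincipalRight₁ = ∀ {n m k t PL PR X Y} → Principalʳ X Y (χ ^ t) PL PR →
      Q ⊢[ n , m , k ] (PL ++ X) ⇒ (PR ++ Y) → Inverted n m k t X Y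

    PrincipalRight₂ : Set
    PrincipalRight₂ = ∀ {n m k t PL₁ PR₁ PL₂ PR₂ X₁ Y₁ X₂ Y₂} → Principal₂ʳ (χ ^ t) PL₁ PR₁ PL₂ PR₂ →
      Q ⊢[ n , m , k ] (PL₁ ++ X₁) ⇒ (PR₁ ++ Y₁) → Q ⊢[ n , m , k ] (PL₂ ++ X₂) ⇒ (PR₂ ++ Y₂) →
      erase X₁ ≡ erase X₂ → erase Y₁ ≡ erase Y₂ → Inverted n m k t (merge X₁ X₂) (merge Y₁ Y₂)

    invertʳ : PrincipalRight₁ → PrincipalRight₂ → ∀ n → Q ⊢[ n , m , k ] Γ ⇒ ((χ ^ t) ∷ Δ) → Inverted n m k t Γ Δ
    invertʳ principal₁ principal₂ n D with lastRule D | ⊢-endsequent D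
    ... | initial i zΓ (_ ∷ zΔ) | _ =
      inverted (reduct-zero _) ≼-refl ≼-refl
        (⊢-initial (Initial-++ (Initial-∷⁻ʳ χ-nonInitial i))
                   (All-++ (annotate-zero ante) zΓ) (All-++ (annotate-zero succ) zΔ))
    ... | rule₁ R fX fY D′ σ π | Γ≤k , t⊔Δ≤k with locate π
    ...   | inj₁ (p , π′) =
      let P , σ′ , π″ = principalʳ R fX fY p σ π′ in Inverted-weaken (n≤1+n _) (Inverted-↭ (principal₁ P D′) σ′ π″)
    ...   | inj₂ (q , π′) with freshen R fX fY reductVars D′
    ...     | _ , _ , R′ , fX′ , fY′ , fV , D″ =
      reapply₁ R′ fX′ (FreshFor-⊆ R′ (fvL-─ q) fY′) fV (invertʳ principal₁ principal₂ _ (⊢-↭ D″ ↭-refl (↭-pull _ q)))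
        σ π′ (proj₁ (⊔-≤⁻ _ _ t⊔Δ≤k)) Γ≤k (proj₂ (⊔-≤⁻ _ _ t⊔Δ≤k))
    invertʳ principal₁ principal₂ n D | rule₂ R R≤m D₁ D₂ eX eY σ π | Γ≤k , t⊔Δ≤k with locate π
    ...   | inj₁ (p , π′) =
      let P , σ′ , π″ = principal₂ʳ R p σ π′
      in Inverted-weaken (n≤1+n _) (Inverted-↭ (principal₂ P D₁ D₂ eX eY) σ′ π″)
    ...   | inj₂ (q , π′) with ∈-merge⁻ eY q
    ...     | _ , _ , q₁ , q₂ , refl , ─≡ , e─ =
      reapply₂ R R≤m (invertʳ principal₁ principal₂ _ (⊢-↭ D₁ ↭-refl (↭-pull _ q₁)))
                     (invertʳ principal₁ principal₂ _ (⊢-↭ D₂ ↭-refl (↭-pull _ q₂)))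
        eX e─ σ (subst (λ Z → _ ↭ _ ++ Z) ─≡ π′) (proj₁ (⊔-≤⁻ _ _ t⊔Δ≤k)) Γ≤k (proj₂ (⊔-≤⁻ _ _ t⊔Δ≤k))

  -- The inversions (i)–(v)

  inversion : (χ : Fm {L}) → NonInitial χ → (ante succ : List (Fm {L})) → Inversion
  inversion χ χ-ni ante succ = record
    { χ = χ ; χ-nonInitial = χ-ni ; ante = ante ; succ = succ
    ; bound = λ a → a ; bound-mono = λ a≤b → a≤b ; bound-≤ = λ _ → ≤-refl }

  -- The premise of a T-rule is one T-level lower than its conclusion.
  T-inversion : (φ : Fm {L}) (ante succ : List (Fm {L})) → Inversion
  T-inversion φ ante succ = record
    { χ = T ⌜ φ ⌝ ; χ-nonInitial = (λ ()) , (λ ()) , (λ ()) ; ante = ante ; succ = succ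
    ; bound = pred ; bound-mono = pred-mono-≤ ; bound-≤ = λ _ → pred[n]≤n }

  ¬-inversion : (φ : Fm {L}) (ante succ : List (Fm {L})) → Inversion
  ¬-inversion φ = inversion (¬ᶠ φ) ((λ ()) , (λ ()) , (λ ()))

  ∧-inversion : (φ ψ : Fm {L}) (ante succ : List (Fm {L})) → Inversion
  ∧-inversion φ ψ = inversion (φ ∧ᶠ ψ) ((λ ()) , (λ ()) , (λ ()))

  ∀-inversion : (φ : Fm {L}) (ante succ : List (Fm {L})) → Inversion
  ∀-inversion φ = inversion (∀ᶠ φ) ((λ ()) , (λ ()) , (λ ()))

  T-principalˡ : ∀ {φ} → Sentence φ → PrincipalLeft (T-inversion φ (φ ∷ []) [])
  T-principalˡ {φ} sφ (T sψ ⌜φ⌝≡⌜ψ⌝) D with ⌜⌝-inj φ _ sφ sψ ⌜φ⌝≡⌜ψ⌝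
  ... | refl = inverted ((refl , ≤-refl) ∷ [] , []) ≼-refl ≼-refl D

  T-principalʳ : ∀ {φ} → Sentence φ → PrincipalRight₁ (T-inversion φ [] (φ ∷ []))
  T-principalʳ {φ} sφ (T sψ ⌜φ⌝≡⌜ψ⌝) D with ⌜⌝-inj φ _ sφ sψ ⌜φ⌝≡⌜ψ⌝
  ... | refl = inverted ([] , (refl , ≤-refl) ∷ []) ≼-refl ≼-refl D

  ¬-principalˡ : ∀ φ → PrincipalLeft (¬-inversion φ [] (φ ∷ []))
  ¬-principalˡ φ (¬ᶠ _) D = inverted ([] , (refl , ≤-refl) ∷ []) ≼-refl ≼-refl D

  ¬-principalʳ : ∀ φ → PrincipalRight₁ (¬-inversion φ (φ ∷ []) [])
  ¬-principalʳ φ (¬ᶠ _) D = inverted ((refl , ≤-refl) ∷ [] , []) ≼-refl ≼-refl D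

  ∧-principalˡ : ∀ φ ψ → PrincipalLeft (∧-inversion φ ψ (φ ∷ ψ ∷ []) [])
  ∧-principalˡ φ ψ (_∧ᶠ_ _ _ {a} {b}) D =
    inverted ((refl , m≤m⊔n a b) ∷ (refl , m≤n⊔m a b) ∷ [] , []) ≼-refl ≼-refl D

  ∧-principal₁ʳ : ∀ φ ψ → PrincipalRight₂ (∧-inversion φ ψ [] (φ ∷ []))
  ∧-principal₁ʳ φ ψ (_∧ᶠ_ _ _ {a} {b}) D₁ D₂ eX eY =
    inverted ([] , (refl , m≤m⊔n a b) ∷ []) (≼-mergeˡ eX) (≼-mergeˡ eY) D₁

  ∧-principal₂ʳ : ∀ φ ψ → PrincipalRight₂ (∧-inversion φ ψ [] (ψ ∷ []))
  ∧-principal₂ʳ φ ψ (_∧ᶠ_ _ _ {a} {b}) D₁ D₂ eX eY =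
    inverted ([] , (refl , m≤n⊔m a b) ∷ []) (≼-mergeʳ eX) (≼-mergeʳ eY) D₂

  ∀-principalʳ : ∀ φ y → PrincipalRight₁ (∀-inversion φ [] (φ [ fvar y ] ∷ []))
  ∀-principalʳ φ y (∀ᶠ _ w w∉X w∉Y w∉φ) D =
    inverted ([] , (refl , ≤-refl) ∷ []) ≼-refl ≼-refl (⊢-rename-eigenvariable y w∉X w∉Y w∉φ D)

  T-left-inversion : ∀ n m k (Γ Δ : List Occ) (φ : Fm) (t : ℕ) → Sentence φ →
    Q ⊢[ n , m , k ] ((T ⌜ φ ⌝ ^ t) ∷ Γ) ⇒ Δ →
    ∃ λ Γ' → ∃ λ Δ' → ∃ λ t' →
      Γ' ≼ Γ × Δ' ≼ Δ × (t ≡ 0 → t' ≤ t) × (0 < t → t' < t) × Q ⊢[ n , m , k ] ((φ ^ t') ∷ Γ') ⇒ Δ'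
  T-left-inversion n m k Γ Δ φ t sφ D with invertˡ (T-inversion φ (φ ∷ []) []) (T-principalˡ sφ) n D
  ... | inverted ((refl , t′≤) ∷ [] , []) Γ′≼ Δ′≼ D′ =
    -, -, -, Γ′≼ , Δ′≼ , (λ _ → ≤pred⇒≤ t′≤) , (λ { (s≤s _) → m≤pred[n]⇒suc[m]≤n t′≤ }) , D′

  T-right-inversion : ∀ n m k (Γ Δ : List Occ) (φ : Fm) (t : ℕ) → Sentence φ →
    Q ⊢[ n , m , k ] Γ ⇒ ((T ⌜ φ ⌝ ^ t) ∷ Δ) →
    ∃ λ Γ' → ∃ λ Δ' → ∃ λ t' →
      Γ' ≼ Γ × Δ' ≼ Δ × (t ≡ 0 → t' ≤ t) × (0 < t → t' < t) × Q ⊢[ n , m , k ] Γ' ⇒ ((φ ^ t') ∷ Δ')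
  T-right-inversion n m k Γ Δ φ t sφ D with invertʳ (T-inversion φ [] (φ ∷ [])) (T-principalʳ sφ) (λ ()) n D
  ... | inverted ([] , (refl , t′≤) ∷ []) Γ′≼ Δ′≼ D′ =
    -, -, -, Γ′≼ , Δ′≼ , (λ _ → ≤pred⇒≤ t′≤) , (λ { (s≤s _) → m≤pred[n]⇒suc[m]≤n t′≤ }) , D′

  ¬-left-inversion : ∀ n m k (Γ Δ : List Occ) (φ : Fm) (t : ℕ) →
    Q ⊢[ n , m , k ] ((¬ᶠ φ ^ t) ∷ Γ) ⇒ Δ →
    ∃ λ Γ' → ∃ λ Δ' → ∃ λ t' → Γ' ≼ Γ × Δ' ≼ Δ × t' ≤ t × Q ⊢[ n , m , k ] Γ' ⇒ ((φ ^ t') ∷ Δ')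
  ¬-left-inversion n m k Γ Δ φ t D with invertˡ _ (¬-principalˡ φ) n D
  ... | inverted ([] , (refl , t′≤t) ∷ []) Γ′≼ Δ′≼ D′ = -, -, -, Γ′≼ , Δ′≼ , t′≤t , D′

  ¬-right-inversion : ∀ n m k (Γ Δ : List Occ) (φ : Fm) (t : ℕ) →
    Q ⊢[ n , m , k ] Γ ⇒ ((¬ᶠ φ ^ t) ∷ Δ) →
    ∃ λ Γ' → ∃ λ Δ' → ∃ λ t' → Γ' ≼ Γ × Δ' ≼ Δ × t' ≤ t × Q ⊢[ n , m , k ] ((φ ^ t') ∷ Γ') ⇒ Δ'
  ¬-right-inversion n m k Γ Δ φ t D with invertʳ _ (¬-principalʳ φ) (λ ()) n D
  ... | inverted ((refl , t′≤t) ∷ [] , []) Γ′≼ Δ′≼ D′ = -, -, -, Γ′≼ , Δ′≼ , t′≤t , D′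

  ∧-left-inversion : ∀ n m k (Γ Δ : List Occ) (φ ψ : Fm) (t : ℕ) →
    Q ⊢[ n , m , k ] (((φ ∧ᶠ ψ) ^ t) ∷ Γ) ⇒ Δ →
    ∃ λ Γ' → ∃ λ Δ' → ∃ λ a → ∃ λ b →
      Γ' ≼ Γ × Δ' ≼ Δ × a ≤ t × b ≤ t × Q ⊢[ n , m , k ] ((φ ^ a) ∷ (ψ ^ b) ∷ Γ') ⇒ Δ'
  ∧-left-inversion n m k Γ Δ φ ψ t D with invertˡ _ (∧-principalˡ φ ψ) n D
  ... | inverted ((refl , a≤t) ∷ (refl , b≤t) ∷ [] , []) Γ′≼ Δ′≼ D′ = -, -, -, -, Γ′≼ , Δ′≼ , a≤t , b≤t , D′

  ∧-right-inversion : ∀ n m k (Γ Δ : List Occ) (φ ψ : Fm) (t : ℕ) →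
    Q ⊢[ n , m , k ] Γ ⇒ (((φ ∧ᶠ ψ) ^ t) ∷ Δ) →
    (∃ λ Γ' → ∃ λ Δ' → ∃ λ a → Γ' ≼ Γ × Δ' ≼ Δ × a ≤ t × Q ⊢[ n , m , k ] Γ' ⇒ ((φ ^ a) ∷ Δ')) ×
    (∃ λ Γ' → ∃ λ Δ' → ∃ λ b → Γ' ≼ Γ × Δ' ≼ Δ × b ≤ t × Q ⊢[ n , m , k ] Γ' ⇒ ((ψ ^ b) ∷ Δ'))
  ∧-right-inversion n m k Γ Δ φ ψ t D
    with invertʳ _ (λ ()) (∧-principal₁ʳ φ ψ) n D | invertʳ _ (λ ()) (∧-principal₂ʳ φ ψ) n D
  ... | inverted ([] , (refl , a≤t) ∷ []) Γ′≼ Δ′≼ D′ | inverted ([] , (refl , b≤t) ∷ []) Γ″≼ Δ″≼ D″ =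
    (-, -, -, Γ′≼ , Δ′≼ , a≤t , D′) , (-, -, -, Γ″≼ , Δ″≼ , b≤t , D″)

  ∀-right-inversion : ∀ n m k (Γ Δ : List Occ) (φ : Fm) (t : ℕ) (y : ℕ) →
    y ∉ fvL Γ → y ∉ fvL Δ → y ∉ fvF (∀ᶠ φ) →
    Q ⊢[ n , m , k ] Γ ⇒ ((∀ᶠ φ ^ t) ∷ Δ) →
    ∃ λ Γ' → ∃ λ Δ' → ∃ λ t' → Γ' ≼ Γ × Δ' ≼ Δ × t' ≤ t × Q ⊢[ n , m , k ] Γ' ⇒ ((φ [ fvar y ] ^ t') ∷ Δ')
  ∀-right-inversion n m k Γ Δ φ t y _ _ _ D with invertʳ _ (∀-principalʳ φ y) (λ ()) n D
  ... | inverted ([] , (refl , t′≤t) ∷ []) Γ′≼ Δ′≼ D′ = -, -, -, Γ′≼ , Δ′≼ , t′≤t , D′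

mainTheorem2 : ∀ {L : Language} (Q : Quotation L) → let open Quotation Q in
    -- (i) inversion for T, left
    (∀ n m k (Γ Δ : List Occ) (φ : Fm) (t : ℕ) → Sentence φ →
      Q ⊢[ n , m , k ] ((T ⌜ φ ⌝ ^ t) ∷ Γ) ⇒ Δ →
      ∃ λ Γ' → ∃ λ Δ' → ∃ λ t' →
        Γ' ≼ Γ × Δ' ≼ Δ × (t ≡ 0 → t' ≤ t) × (0 < t → t' < t) ×
        Q ⊢[ n , m , k ] ((φ ^ t') ∷ Γ') ⇒ Δ')
    ×
    -- (i) inversion for T, right
    (∀ n m k (Γ Δ : List Occ) (φ : Fm) (t : ℕ) → Sentence φ →
      Q ⊢[ n , m , k ] Γ ⇒ ((T ⌜ φ ⌝ ^ t) ∷ Δ) →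
      ∃ λ Γ' → ∃ λ Δ' → ∃ λ t' →
        Γ' ≼ Γ × Δ' ≼ Δ × (t ≡ 0 → t' ≤ t) × (0 < t → t' < t) ×
        Q ⊢[ n , m , k ] Γ' ⇒ ((φ ^ t') ∷ Δ'))
    ×
    -- (ii) inversion for ¬, left
    (∀ n m k (Γ Δ : List Occ) (φ : Fm) (t : ℕ) →
      Q ⊢[ n , m , k ] ((¬ᶠ φ ^ t) ∷ Γ) ⇒ Δ →
      ∃ λ Γ' → ∃ λ Δ' → ∃ λ t' →
        Γ' ≼ Γ × Δ' ≼ Δ × t' ≤ t ×
        Q ⊢[ n , m , k ] Γ' ⇒ ((φ ^ t') ∷ Δ'))
    ×
    -- (ii) inversion for ¬, right
    (∀ n m k (Γ Δ : List Occ) (φ : Fm) (t : ℕ) →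
      Q ⊢[ n , m , k ] Γ ⇒ ((¬ᶠ φ ^ t) ∷ Δ) →
      ∃ λ Γ' → ∃ λ Δ' → ∃ λ t' →
        Γ' ≼ Γ × Δ' ≼ Δ × t' ≤ t ×
        Q ⊢[ n , m , k ] ((φ ^ t') ∷ Γ') ⇒ Δ')
    ×
    -- (iii) inversion for ∧, left
    (∀ n m k (Γ Δ : List Occ) (φ ψ : Fm) (t : ℕ) →
      Q ⊢[ n , m , k ] (((φ ∧ᶠ ψ) ^ t) ∷ Γ) ⇒ Δ →
      ∃ λ Γ' → ∃ λ Δ' → ∃ λ a → ∃ λ b →
        Γ' ≼ Γ × Δ' ≼ Δ × a ≤ t × b ≤ t ×
        Q ⊢[ n , m , k ] ((φ ^ a) ∷ (ψ ^ b) ∷ Γ') ⇒ Δ')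
    ×
    -- (iv) inversion for ∧, right
    (∀ n m k (Γ Δ : List Occ) (φ ψ : Fm) (t : ℕ) →
      Q ⊢[ n , m , k ] Γ ⇒ (((φ ∧ᶠ ψ) ^ t) ∷ Δ) →
      (∃ λ Γ' → ∃ λ Δ' → ∃ λ a →
        Γ' ≼ Γ × Δ' ≼ Δ × a ≤ t ×
        Q ⊢[ n , m , k ] Γ' ⇒ ((φ ^ a) ∷ Δ'))
      ×
      (∃ λ Γ' → ∃ λ Δ' → ∃ λ b →
        Γ' ≼ Γ × Δ' ≼ Δ × b ≤ t ×
        Q ⊢[ n , m , k ] Γ' ⇒ ((ψ ^ b) ∷ Δ')))
    ×
    -- (v) inversion for ∀, right
    (∀ n m k (Γ Δ : List Occ) (φ : Fm) (t : ℕ) (y : ℕ) →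
      y ∉ fvL Γ → y ∉ fvL Δ → y ∉ fvF (∀ᶠ φ) →
      Q ⊢[ n , m , k ] Γ ⇒ ((∀ᶠ φ ^ t) ∷ Δ) →
      ∃ λ Γ' → ∃ λ Δ' → ∃ λ t' →
        Γ' ≼ Γ × Δ' ≼ Δ × t' ≤ t ×
        Q ⊢[ n , m , k ] Γ' ⇒ ((φ [ fvar y ] ^ t') ∷ Δ'))
mainTheorem2 Q =
  T-left-inversion Q , T-right-inversion Q , ¬-left-inversion Q , ¬-right-inversion Q ,
  ∧-left-inversion Q , ∧-right-inversion Q , ∀-right-inversion Q
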